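{- Let $a\ge 2$, and let $\widetilde w\in\widetilde{\mathfrak S}_a$ be a minimal-length representative of its coset in $\widetilde{\mathfrak S}_a/\mathfrak S_a$ (equivalently, $\widetilde w^{ -1}\mathcal A^\circ\subseteq C$). Then the number of boxes of the $a$-core $\widetilde w\cdot\emptyset$ equals ${\sf size}(\widetilde w)=\sum_{\alpha+k\delta\in{\sf inv}(\widetilde w^{ -1})}k$.
   Context: The affine symmetric group $\widetilde{\mathfrak S}_a$ is the affine Weyl group of the root system $\Phi$ of type $A_{a-1}$ (in a Euclidean space $V$, simple roots $\alpha_1,\dots,\alpha_{a-1}$, highest root $\tilde\alpha$), generated by $s_i=$ reflection in $\{\langle x,\alpha_i\rangle=0\}$ for $1\le i\le a-1$ and $s_0=$ reflection in $\{\langle x,\tilde\alpha\rangle=1\}$; $\mathfrak S_a=\langle s_1,\dots,s_{a-1}\rangle$. $C=\{x:\langle x,\alpha_i\rangle>0\ \forall i\}$ is the dominant chamber and $\mathcal A^\circ=\{x:\langle x,\alpha_i\rangle>0\ \forall i,\ \langle x,\tilde\alpha\rangle<1\}$. An $a$-core is a partition with no hook length divisible by $a$; the box in row $i$, column $j$ has content $(j-i)\bmod a$. $\widetilde{\mathfrak S}_a$ acts on $a$-cores by letting $s_i\lambda$ ($0\le i\le a-1$) be the unique $a$-core differing from $\lambda$ only in boxes of content $i$; $\emptyset$ is the empty partition. Affine roots $\alpha+k\delta$ ($\alpha\in\Phi$, $k\in\mathbb Z$) are acted on by $wt_\mu$ ($w\in\mathfrak S_a$, $\mu$ in the coroot lattice,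 $t_\mu$ translation) via $wt_\mu(\alpha+k\delta)=w(\alpha)+(k-\langle\mu,\alpha\rangle)\delta$; positive affine roots are $\alpha+k\delta$ with either $\alpha\in\Phi^+,k\ge0$ or $\alpha\in-\Phi^+,k>0$; ${\sf inv}(\widetilde u)$ is the set of positive affine roots $\beta$ with $\widetilde u^{ -1}(\beta)$ negative. -}

module Defs where

open import Data.Nat as ℕ using (ℕ; zero; suc; _∸_; _<_; _≥_)
open import Data.Nat.Divisibility using (_∣_)
open import Data.Integer as ℤ using (ℤ; +_; 0ℤ; _-_; -_)
import Data.Integer.Divisibility as ℤDiv
open import Data.Fin as Fin using (Fin; toℕ; inject₁; fromℕ)
open import Data.Fin.Permutation as P using (Permutation′; _⟨$⟩ʳ_; _⟨$⟩ˡ_; transpose; flip; _∘ₚ_)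
open import Data.List using (List; []; _∷_; length; map; filter; foldr)
open import Data.Nat.ListAction using (sum)
open import Data.List.Relation.Unary.All using (All)
open import Data.List.Relation.Unary.Linked using (Linked)
open import Data.List.Relation.Unary.Unique.Propositional using (Unique)
open import Data.List.Membership.Propositional using (_∈_)
open import Data.Product using (Σ; _×_; _,_)
open import Data.Sum using (_⊎_)
open import Relation.Nullary using (¬_)
open import Relation.Binary.PropositionalEquality using (_≡_; _≢_)
open import Function.Bundles using (_⇔_)

-- Throughout, a = suc m and coordinates are indexed by
-- Fin a = {0,…,a-1} (0-indexed).  V is the sum-zero hyperplane of ℝ^a
-- with the standard inner product; roots are e_i - e_j (i ≠ j), simple
-- roots α_{l} = e_{l-1} - e_l (l = 1..a-1), highest root e_0 - e_{a-1}.
-- Coroot lattice = integer vectors of sum 0 (roots = coroots in type A).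

-- An element w t_μ of the affine Weyl group: w ∈ 𝔖_a (acting on V by
-- permuting coordinates, w e_j = e_{w j}) and μ in the coroot lattice.
-- It acts on V by x ↦ w (x + μ).
record Aff (a : ℕ) : Set where
  constructor _t_
  field
    perm  : Permutation′ a
    trans : Fin a → ℤ
open Aff public

-- equality of affine maps (the action on V is faithful)
_≈_ : ∀ {a} → Aff a → Aff a → Set
u ≈ v = (∀ i → perm u ⟨$⟩ʳ i ≡ perm v ⟨$⟩ʳ i) × (∀ i → trans u i ≡ trans v i)

-- product (w t_μ)(w' t_μ') = w w' t_{w'^{-1} μ + μ'}
_·_ : ∀ {a} → Aff a → Aff a → Aff a
(w t μ) · (w' t μ') = (w' ∘ₚ w) t (λ i → μ (w' ⟨$⟩ʳ i) ℤ.+ μ' i)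

-- inverse (w t_μ)^{-1} = w^{-1} t_{-wμ}
inverse : ∀ {a} → Aff a → Aff a
inverse (w t μ) = flip w t (λ i → - μ (w ⟨$⟩ˡ i))

identity : ∀ {a} → Aff a
identity = P.id t (λ _ → 0ℤ)

-- Generators of the affine symmetric group for a = suc m.
-- s_0 = reflection in ⟨x, α̃⟩ = 1, i.e. x ↦ s_α̃ x + α̃ = s_α̃ t_{-α̃};
-- s_l (l ≥ 1) = reflection in ⟨x, α_l⟩ = 0 = transposition of l-1, l.
minusHighest : ∀ m → Fin (suc m) → ℤ
minusHighest m i with toℕ i ℕ.≟ 0 | toℕ i ℕ.≟ m
... | Relation.Nullary.yes _ | Relation.Nullary.yes _ = 0ℤ
... | Relation.Nullary.yes _ | Relation.Nullary.no _  = - (+ 1)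
... | Relation.Nullary.no _  | Relation.Nullary.yes _ = + 1
... | Relation.Nullary.no _  | Relation.Nullary.no _  = 0ℤ

gen : ∀ m → Fin (suc m) → Aff (suc m)
gen m Fin.zero    = transpose Fin.zero (fromℕ m) t minusHighest m
gen m (Fin.suc l) = transpose (inject₁ l) (Fin.suc l) t (λ _ → 0ℤ)

eval : ∀ m → List (Fin (suc m)) → Aff (suc m)
eval m []      = identity
eval m (i ∷ w) = gen m i · eval m w

LengthLE : ∀ m → Aff (suc m) → ℕ → Set
LengthLE m u n = Σ (List (Fin (suc m))) λ W → (eval m W ≈ u) × (length W ℕ.≤ n)

-- ũ is a minimal-length representative of ũ 𝔖_a, where
-- 𝔖_a = ⟨s_1,…,s_{a-1}⟩: for every v ∈ 𝔖_a, ℓ(ũ) ≤ ℓ(ũ v).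
MinCosetRep : ∀ m → Aff (suc m) → Set
MinCosetRep m u =
  (V : List (Fin m)) (W : List (Fin (suc m))) →
  eval m W ≈ (u · eval m (map Fin.suc V)) → LengthLE m u (length W)

-- Affine roots α + kδ with α = e_i - e_j (i ≠ j), stored as (i , j , k).
AffRoot : ℕ → Set
AffRoot a = Fin a × Fin a × ℤ

-- w t_μ (α + kδ) = w(α) + (k - ⟨μ, α⟩) δ
act : ∀ {a} → Aff a → AffRoot a → AffRoot a
act (w t μ) (i , j , k) = (w ⟨$⟩ʳ i , w ⟨$⟩ʳ j , k - (μ i - μ j))

-- positive affine roots: α ∈ Φ⁺, k ≥ 0, or α ∈ -Φ⁺, k > 0
-- (Φ⁺ = {e_i - e_j : i < j})
Positive : ∀ {a} → AffRoot a → Set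
Positive (i , j , k) = (i Fin.< j × 0ℤ ℤ.≤ k) ⊎ (j Fin.< i × 0ℤ ℤ.< k)

Negative : ∀ {a} → AffRoot a → Set
Negative (i , j , k) = (j Fin.< i × k ℤ.≤ 0ℤ) ⊎ (i Fin.< j × k ℤ.< 0ℤ)

InInv : ∀ {a} → Aff a → AffRoot a → Set
InInv u β = Positive β × Negative (act (inverse u) β)

Enumerates : ∀ {A : Set} → List A → (A → Set) → Set
Enumerates L S = Unique L × (∀ x → (x ∈ L) ⇔ S x)

sumK : ∀ {a} → List (AffRoot a) → ℤ
sumK = foldr (λ { (_ , _ , k) s → k ℤ.+ s }) 0ℤ

-- Partitions and a-cores.  A partition is the list of its (positive,
-- weakly decreasing) row lengths; boxes (r , c) are 0-indexed.

IsPartition : List ℕ → Set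
IsPartition λ′ = Linked _≥_ λ′ × All (0 <_) λ′

rowLen : List ℕ → ℕ → ℕ
rowLen []       _       = 0
rowLen (x ∷ _)  zero    = x
rowLen (_ ∷ xs) (suc r) = rowLen xs r

colLen : List ℕ → ℕ → ℕ
colLen λ′ c = length (filter (c ℕ.<?_) λ′)

InBox : List ℕ → ℕ → ℕ → Set
InBox λ′ r c = c < rowLen λ′ r

hook : List ℕ → ℕ → ℕ → ℕ
hook λ′ r c = (rowLen λ′ r ∸ suc c) ℕ.+ (colLen λ′ c ∸ suc r) ℕ.+ 1

IsCore : ℕ → List ℕ → Set
IsCore a λ′ = IsPartition λ′ × (∀ r c → InBox λ′ r c → ¬ (a ∣ hook λ′ r c))

size : List ℕ → ℕ
size = sum

Content : ∀ a → ℕ → ℕ → Fin a → Set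
Content a r c i = (+ a) ℤDiv.∣ ((+ c - + r) - + toℕ i)

DiffOnly : ∀ a → Fin a → List ℕ → List ℕ → Set
DiffOnly a i λ′ μ = ∀ r c → ¬ Content a r c i → (InBox λ′ r c ⇔ InBox μ r c)

-- μ = s_i λ : the a-core differing from λ only in boxes of content i,
-- chosen different from λ whenever such a core different from λ exists.
SStep : ∀ a → Fin a → List ℕ → List ℕ → Set
SStep a i λ′ μ =
  IsCore a μ × DiffOnly a i λ′ μ ×
  ((Σ (List ℕ) λ ν → IsCore a ν × DiffOnly a i λ′ ν × ν ≢ λ′) → μ ≢ λ′)

data CoreOf (a : ℕ) : List (Fin a) → List ℕ → Set where
  empty : CoreOf a [] []
  step  : ∀ {i W λ′ μ} → CoreOf a W λ′ → SStep a i λ′ μ → CoreOf a (i ∷ W) μ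

-- Read partitions on the abacus with a runners: the beads of λ are the integers
-- λ_r - r - 1.  A partition is an a-core exactly when, on every runner ρ, its
-- beads fill all levels below some height ν ρ.  The generator s_i exchanges the
-- runners i - 1 and i (shifting by one level when i = 0) by moving every movable
-- bead one step, so along a word W the heights of W · ∅ are the translation part
-- of eval W and each letter changes the size by s + ν (i - 1) - ν i.  On the root
-- side, inv ((s_i u)⁻¹) differs from inv (u⁻¹) by exactly one root ± u⁻¹ α_i,
-- and its δ-coefficient is that same number; induction on W concludes.
module Submission where

open import Data.Nat as ℕ using (ℕ; zero; suc; _∸_; z≤n; s≤s)
import Data.Nat.Properties as ℕP
open import Data.Nat.Divisibility using (_∣_; divides; ∣-refl)
open import Data.Integer as ℤ using (ℤ; +_; -_; _-_; 0ℤ; 1ℤ; -1ℤ; -[1+_]; +≤+; +<+)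
import Data.Integer.Properties as ℤP
import Data.Integer.Divisibility.Signed as ℤ∣
open import Data.Integer.DivMod using (a≡a%ℕn+[a/ℕn]*n; n%ℕd<d)
open import Data.Integer.Tactic.RingSolver using (solve-∀)
open import Data.Fin as Fin using (Fin; toℕ; fromℕ; fromℕ<; inject₁)
import Data.Fin.Properties as FinP
open import Data.Fin.Permutation as Perm using (_⟨$⟩ʳ_; _⟨$⟩ˡ_)
import Data.Fin.Permutation.Components as PermC
open import Data.List using (List; []; _∷_; length)
import Data.List.Properties as ListP
open import Data.List.Relation.Unary.Linked as Linked using (Linked; []; [-]; _∷_)
open import Data.List.Relation.Unary.All as All using (All; []; _∷_)
open import Data.List.Relation.Unary.AllPairs using ([]; _∷_)
open import Data.List.Relation.Unary.Any using (here; there)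
open import Data.List.Membership.Propositional using (_∈_)
open import Data.List.Relation.Unary.Unique.Propositional using (Unique)
open import Data.Product using (Σ; _×_; _,_; proj₁; proj₂)
open import Data.Product.Properties using (≡-dec)
open import Data.Sum using (_⊎_; inj₁; inj₂)
open import Data.Empty using (⊥; ⊥-elim)
open import Function.Bundles using (_⇔_; mk⇔; Equivalence)
import Function.Properties.Equivalence as ⇔
open import Relation.Nullary using (¬_; yes; no; Dec)
open import Relation.Nullary.Decidable using (_×-dec_; ¬?; dec-true; dec-false; decidable-stable)
open import Relation.Binary.Definitions using (tri<; tri≈; tri>)
open import Relation.Binary.PropositionalEquality
open import Defs renaming (trans to translation; _t_ to _∘t_)

≤-offset : ∀ {x y} (d : ℕ) → y ≡ x ℤ.+ + d → x ℤ.≤ y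
≤-offset {x} d refl = ℤP.i≤i+j x (+ d)

<-offset : ∀ {x y} (d : ℕ) → y ≡ x ℤ.+ + suc d → x ℤ.< y
<-offset {x} d refl = ℤP.suc[i]≤j⇒i<j (≤-offset d (e x (+ d)))
  where
  e : ∀ x d → x ℤ.+ (1ℤ ℤ.+ d) ≡ (1ℤ ℤ.+ x) ℤ.+ d
  e = solve-∀

opaque
  ≤⇒offset : ∀ {x y} → x ℤ.≤ y → Σ ℕ λ d → y ≡ x ℤ.+ + d
  ≤⇒offset {x} {y} le = ℤ.∣ y - x ∣ , sym (trans (cong (λ w → x ℤ.+ w) (ℤP.0≤i⇒+∣i∣≡i (ℤP.i≤j⇒0≤j-i le))) (e x y))
    where
    e : ∀ x y → x ℤ.+ (y - x) ≡ y
    e = solve-∀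

  <⇒offset : ∀ {x y} → x ℤ.< y → Σ ℕ λ d → y ≡ x ℤ.+ + suc d
  <⇒offset {x} lt with ≤⇒offset (ℤP.i<j⇒suc[i]≤j lt)
  ... | d , eq = d , trans eq (e x (+ d))
    where
    e : ∀ x d → (1ℤ ℤ.+ x) ℤ.+ d ≡ x ℤ.+ (1ℤ ℤ.+ d)
    e = solve-∀

+-∸ : ∀ {m k} → k ℕ.≤ m → + (m ∸ k) ≡ + m - + k
+-∸ {m} {k} le = sym (trans (ℤP.m-n≡m⊖n m k) (ℤP.⊖-≥ le))

≡-by-difference : ∀ {l r a b : ℤ} → a ≡ b → l - r ≡ a - b → l ≡ r
≡-by-difference {l} {r} {a} refl eq = ℤP.i-j≡0⇒i≡j l r (trans eq (ℤP.+-inverseʳ a))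

∣y∣≤n⇒-[1+n]<y : ∀ {n} y → ℤ.∣ y ∣ ℕ.≤ n → - + suc n ℤ.< y
∣y∣≤n⇒-[1+n]<y (+ m) _ = ℤ.-<+
∣y∣≤n⇒-[1+n]<y -[1+ m ] m<n = ℤ.-<- m<n

i+1-1≡i : ∀ z → z ℤ.+ 1ℤ - 1ℤ ≡ z
i+1-1≡i = solve-∀

i-1+1≡i : ∀ z → z - 1ℤ ℤ.+ 1ℤ ≡ z
i-1+1≡i = solve-∀

+1-injective : ∀ {x y} → x ℤ.+ 1ℤ ≡ y ℤ.+ 1ℤ → x ≡ y
+1-injective {x} {y} eq = trans (sym (i+1-1≡i x)) (trans (cong (_- 1ℤ) eq) (i+1-1≡i y))

-1-injective : ∀ {x y} → x - 1ℤ ≡ y - 1ℤ → x ≡ y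
-1-injective {x} {y} eq = trans (sym (i-1+1≡i x)) (trans (cong (ℤ._+ 1ℤ) eq) (i-1+1≡i y))

+1≡⇒≡-1 : ∀ {x y} → x ℤ.+ 1ℤ ≡ y → x ≡ y - 1ℤ
+1≡⇒≡-1 {x} eq = trans (sym (i+1-1≡i x)) (cong (_- 1ℤ) eq)

-1≡⇒≡+1 : ∀ {x y} → x - 1ℤ ≡ y → x ≡ y ℤ.+ 1ℤ
-1≡⇒≡+1 {x} eq = trans (sym (i-1+1≡i x)) (cong (ℤ._+ 1ℤ) eq)

i-j+j≡i : ∀ b c → b - c ℤ.+ c ≡ b
i-j+j≡i = solve-∀

i+j-j≡i : ∀ b c → b ℤ.+ c - c ≡ b
i+j-j≡i = solve-∀

i<j+k⇒i-k<j : ∀ {i j k} → i ℤ.< j ℤ.+ k → i - k ℤ.< j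
i<j+k⇒i-k<j {i} {j} {k} h = subst (i - k ℤ.<_) (i+j-j≡i j k) (ℤP.+-monoˡ-< (- k) h)

i+k<j⇒i<j-k : ∀ {i j k} → i ℤ.+ k ℤ.< j → i ℤ.< j - k
i+k<j⇒i<j-k {i} {j} {k} h = subst (ℤ._< j - k) (i+j-j≡i i k) (ℤP.+-monoˡ-< (- k) h)

i<j-k⇒i+k<j : ∀ {i j k} → i ℤ.< j - k → i ℤ.+ k ℤ.< j
i<j-k⇒i+k<j {i} {j} {k} h = subst (i ℤ.+ k ℤ.<_) (i-j+j≡i j k) (ℤP.+-monoˡ-< k h)

i-k<j⇒i<j+k : ∀ {i j k} → i - k ℤ.< j → i ℤ.< j ℤ.+ k
i-k<j⇒i<j+k {i} {j} {k} h = subst (ℤ._< j ℤ.+ k) (i-j+j≡i i k) (ℤP.+-monoˡ-< k h)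

i≤j-k⇒i+k≤j : ∀ {i j k} → i ℤ.≤ j - k → i ℤ.+ k ℤ.≤ j
i≤j-k⇒i+k≤j {i} {j} {k} h = subst (i ℤ.+ k ℤ.≤_) (i-j+j≡i j k) (ℤP.+-monoˡ-≤ k h)

i≤j+k⇒i-k≤j : ∀ {i j k} → i ℤ.≤ j ℤ.+ k → i - k ℤ.≤ j
i≤j+k⇒i-k≤j {i} {j} {k} h = subst (i - k ℤ.≤_) (i+j-j≡i j k) (ℤP.+-monoˡ-≤ (- k) h)

private
  -i+[i+j]≡j : ∀ c x → - c ℤ.+ (c ℤ.+ x) ≡ x
  -i+[i+j]≡j = solve-∀

+-cancelˡ-≡ : ∀ c {x y} → c ℤ.+ x ≡ c ℤ.+ y → x ≡ y
+-cancelˡ-≡ c {x} {y} h = subst₂ _≡_ (-i+[i+j]≡j c x) (-i+[i+j]≡j c y) (cong (λ w → - c ℤ.+ w) h)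

+-cancelˡ-< : ∀ c {x y} → c ℤ.+ x ℤ.< c ℤ.+ y → x ℤ.< y
+-cancelˡ-< c {x} {y} h = subst₂ ℤ._<_ (-i+[i+j]≡j c x) (-i+[i+j]≡j c y) (ℤP.+-monoʳ-< (- c) h)

≤⇒<⊎≡ : ∀ {a b : ℤ} → a ℤ.≤ b → a ℤ.< b ⊎ a ≡ b
≤⇒<⊎≡ {a} {b} le with a ℤ.≟ b
... | yes e = inj₂ e
... | no ne = inj₁ (ℤP.≤∧≢⇒< le ne)

-- Partitions and their beads

-- Rows beyond the length of λ contribute the beads -(r + 1), so the bead set
-- is infinite downwards.
opaque
  beta : List ℕ → ℕ → ℤ
  beta λ′ r = + rowLen λ′ r - + suc r

  beta-def : ∀ λ′ r → beta λ′ r ≡ + rowLen λ′ r - + suc r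
  beta-def λ′ r = refl

Bead : List ℕ → ℤ → Set
Bead λ′ z = Σ ℕ λ r → beta λ′ r ≡ z

rowLen-≤-head : ∀ {h t} → Linked ℕ._≥_ (h ∷ t) → ∀ r → rowLen (h ∷ t) r ℕ.≤ h
rowLen-≤-head _ zero = ℕP.≤-refl
rowLen-≤-head [-] (suc r) = z≤n
rowLen-≤-head (h≥y ∷ L) (suc r) = ℕP.≤-trans (rowLen-≤-head L r) h≥y

rowLen-suc-≤ : ∀ {λ′} → Linked ℕ._≥_ λ′ → ∀ r → rowLen λ′ (suc r) ℕ.≤ rowLen λ′ r
rowLen-suc-≤ [] r = z≤n
rowLen-suc-≤ [-] zero = z≤n
rowLen-suc-≤ [-] (suc r) = z≤n
rowLen-suc-≤ (h≥y ∷ L) zero = h≥y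
rowLen-suc-≤ (h≥y ∷ L) (suc r) = rowLen-suc-≤ L r

rowLen-antitone : ∀ {λ′} → Linked ℕ._≥_ λ′ → ∀ {r s} → r ℕ.≤ s → rowLen λ′ s ℕ.≤ rowLen λ′ r
rowLen-antitone L {s = zero} z≤n = ℕP.≤-refl
rowLen-antitone L {r} {suc s} r≤1+s with ℕP.m≤n⇒m<n∨m≡n r≤1+s
... | inj₁ (s≤s r≤s) = ℕP.≤-trans (rowLen-suc-≤ L s) (rowLen-antitone L r≤s)
... | inj₂ refl = ℕP.≤-refl

rowLen-beyond : ∀ λ′ r → length λ′ ℕ.≤ r → rowLen λ′ r ≡ 0
rowLen-beyond [] r _ = refl
rowLen-beyond (h ∷ t) (suc r) (s≤s le) = rowLen-beyond t r le

rowLen-injective : ∀ {λ′ μ} → All (0 ℕ.<_) λ′ → All (0 ℕ.<_) μ → (∀ r → rowLen λ′ r ≡ rowLen μ r) → λ′ ≡ μ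
rowLen-injective [] [] f = refl
rowLen-injective [] (h>0 ∷ _) f = ⊥-elim (ℕP.<-irrefl (f 0) h>0)
rowLen-injective (h>0 ∷ _) [] f = ⊥-elim (ℕP.<-irrefl (sym (f 0)) h>0)
rowLen-injective (_ ∷ a) (_ ∷ b) f = cong₂ _∷_ (f 0) (rowLen-injective a b (λ r → f (suc r)))

beta-beyond : ∀ λ′ r → length λ′ ℕ.≤ r → beta λ′ r ≡ - + suc r
beta-beyond λ′ r le rewrite beta-def λ′ r | rowLen-beyond λ′ r le = refl

beta-far : ∀ λ′ {N} y → length λ′ ℕ.≤ N → ℤ.∣ y ∣ ℕ.≤ N → beta λ′ N ℤ.< y
beta-far λ′ y beyond small = subst (ℤ._< y) (sym (beta-beyond λ′ _ beyond)) (∣y∣≤n⇒-[1+n]<y y small)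

beta-lower : ∀ λ′ r → - + suc r ℤ.≤ beta λ′ r
beta-lower λ′ r rewrite beta-def λ′ r = ≤-offset (rowLen λ′ r) (e (+ rowLen λ′ r) (+ suc r))
  where
  e : ∀ a b → a - b ≡ - b ℤ.+ a
  e = solve-∀

beta-strict : ∀ {λ′} → Linked ℕ._≥_ λ′ → ∀ {r s} → r ℕ.< s → beta λ′ s ℤ.< beta λ′ r
beta-strict {λ′} L {r} {s} r<s = <-offset (d₁ ℕ.+ d₂) (begin
    beta λ′ r                                                       ≡⟨ split ⟩
    beta λ′ s ℤ.+ ((+ rowLen λ′ r - + rowLen λ′ s) ℤ.+ (+ s - + r)) ≡⟨ cong (λ w → beta λ′ s ℤ.+ w) (cong₂ ℤ._+_ (sym h₁) (sym h₂)) ⟩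
    beta λ′ s ℤ.+ (+ d₁ ℤ.+ + suc d₂)                               ≡⟨ cong (λ w → beta λ′ s ℤ.+ w) (sym (ℤP.pos-+ d₁ (suc d₂))) ⟩
    beta λ′ s ℤ.+ + (d₁ ℕ.+ suc d₂)                                 ≡⟨ cong (λ d → beta λ′ s ℤ.+ + d) (ℕP.+-suc d₁ d₂) ⟩
    beta λ′ s ℤ.+ + suc (d₁ ℕ.+ d₂)                                 ∎)
  where
  open ≡-Reasoning
  d₁ = rowLen λ′ r ∸ rowLen λ′ s
  d₂ = s ∸ suc r
  h₁ : + d₁ ≡ + rowLen λ′ r - + rowLen λ′ s
  h₁ = +-∸ (rowLen-antitone L (ℕP.<⇒≤ r<s))
  h₂ : + suc d₂ ≡ + s - + r
  h₂ = trans (cong +_ (sym (ℕP.+-∸-assoc 1 r<s))) (+-∸ (ℕP.<⇒≤ r<s))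
  split : beta λ′ r ≡ beta λ′ s ℤ.+ ((+ rowLen λ′ r - + rowLen λ′ s) ℤ.+ (+ s - + r))
  split rewrite beta-def λ′ r | beta-def λ′ s = e (+ rowLen λ′ r) (+ rowLen λ′ s) (+ r) (+ s)
    where
    e : ∀ a b r s → a - (1ℤ ℤ.+ r) ≡ b - (1ℤ ℤ.+ s) ℤ.+ ((a - b) ℤ.+ (s - r))
    e = solve-∀

beta-injective : ∀ {λ′} → Linked ℕ._≥_ λ′ → ∀ {r s} → beta λ′ r ≡ beta λ′ s → r ≡ s
beta-injective L {r} {s} eq with ℕP.<-cmp r s
... | tri< lt _ _ = ⊥-elim (ℤP.<-irrefl (sym eq) (beta-strict L lt))
... | tri≈ _ e _ = e
... | tri> _ _ gt = ⊥-elim (ℤP.<-irrefl eq (beta-strict L gt))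

beta-antitone : ∀ {λ′} → Linked ℕ._≥_ λ′ → ∀ {r s} → r ℕ.≤ s → beta λ′ s ℤ.≤ beta λ′ r
beta-antitone L le with ℕP.m≤n⇒m<n∨m≡n le
... | inj₁ lt = ℤP.<⇒≤ (beta-strict L lt)
... | inj₂ refl = ℤP.≤-refl

beta-≡⇒rowLen-≡ : ∀ {λ′ μ} r → beta μ r ≡ beta λ′ r → rowLen μ r ≡ rowLen λ′ r
beta-≡⇒rowLen-≡ {λ′} {μ} r eq = ℤP.+-injective (≡-by-difference (trans (sym (beta-def μ r)) (trans eq (beta-def λ′ r))) (e (+ rowLen μ r) (+ rowLen λ′ r) (+ r)))
  where
  e : ∀ M R r → M - R ≡ (M - (1ℤ ℤ.+ r)) - (R - (1ℤ ℤ.+ r))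
  e = solve-∀

beta-≡⇒≡ : ∀ {λ′ μ} → IsPartition λ′ → IsPartition μ → (∀ r → beta μ r ≡ beta λ′ r) → μ ≡ λ′
beta-≡⇒≡ (_ , Aλ) (_ , Aμ) eq = rowLen-injective Aμ Aλ (λ r → beta-≡⇒rowLen-≡ r (eq r))

colLen-accept : ∀ {h} t c → c ℕ.< h → colLen (h ∷ t) c ≡ suc (colLen t c)
colLen-accept t c lt = cong length (ListP.filter-accept (c ℕ.<?_) lt)

colLen-reject : ∀ {h} t c → ¬ c ℕ.< h → colLen (h ∷ t) c ≡ colLen t c
colLen-reject t c nlt = cong length (ListP.filter-reject (c ℕ.<?_) nlt)

colLen-≡ : ∀ λ′ c k → (∀ s → s ℕ.< k → c ℕ.< rowLen λ′ s) → (∀ s → k ℕ.≤ s → rowLen λ′ s ℕ.≤ c) → colLen λ′ c ≡ k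
colLen-≡ [] c zero f g = refl
colLen-≡ [] c (suc k) f g with f 0 (s≤s z≤n)
... | ()
colLen-≡ (h ∷ t) c k f g with c ℕ.<? h
colLen-≡ (h ∷ t) c zero f g | yes c<h = ⊥-elim (ℕP.<⇒≱ c<h (g 0 z≤n))
colLen-≡ (h ∷ t) c (suc k) f g | yes c<h = trans (colLen-accept t c c<h) (cong suc (colLen-≡ t c k (λ s s<k → f (suc s) (s≤s s<k)) (λ s k≤s → g (suc s) (s≤s k≤s))))
colLen-≡ (h ∷ t) c zero f g | no c≮h = trans (colLen-reject t c c≮h) (colLen-≡ t c zero (λ s ()) (λ s _ → g (suc s) z≤n))
colLen-≡ (h ∷ t) c (suc k) f g | no c≮h = ⊥-elim (c≮h (f 0 (s≤s z≤n)))

<-colLen⇒<-rowLen : ∀ {λ′} → Linked ℕ._≥_ λ′ → ∀ c s → s ℕ.< colLen λ′ c → c ℕ.< rowLen λ′ s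
<-colLen⇒<-rowLen {[]} L c s ()
<-colLen⇒<-rowLen {h ∷ t} L c s lt with c ℕ.<? h
<-colLen⇒<-rowLen {h ∷ t} L c zero lt | yes c<h = c<h
<-colLen⇒<-rowLen {h ∷ t} L c (suc s) lt | yes c<h = <-colLen⇒<-rowLen (Linked.tail L) c s (ℕP.≤-pred (subst (suc s ℕ.<_) (colLen-accept t c c<h) lt))
... | no c≮h = ⊥-elim (ℕP.<⇒≱ (subst (s ℕ.<_) (trans (colLen-reject t c c≮h) k0) lt) z≤n)
  where
  k0 : colLen t c ≡ 0
  k0 = colLen-≡ t c 0 (λ s ()) (λ s _ → ℕP.≮⇒≥ λ c<ts → c≮h (ℕP.<-≤-trans c<ts (rowLen-≤-head L (suc s))))

<-rowLen⇒<-colLen : ∀ {λ′} → Linked ℕ._≥_ λ′ → ∀ c s → c ℕ.< rowLen λ′ s → s ℕ.< colLen λ′ c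
<-rowLen⇒<-colLen {[]} L c s ()
<-rowLen⇒<-colLen {h ∷ t} L c s lt with c ℕ.<? h
<-rowLen⇒<-colLen {h ∷ t} L c zero lt | yes c<h rewrite colLen-accept t c c<h = s≤s z≤n
<-rowLen⇒<-colLen {h ∷ t} L c (suc s) lt | yes c<h rewrite colLen-accept t c c<h = s≤s (<-rowLen⇒<-colLen (Linked.tail L) c s lt)
... | no c≮h = ⊥-elim (c≮h (ℕP.<-≤-trans lt (rowLen-≤-head L s)))

-- The hook of box (r, c) is the distance from the bead of row r down to the
-- gap c - λ'_c that the column of c leaves below it.
hook-beta : ∀ λ′ r c → c ℕ.< rowLen λ′ r → r ℕ.< colLen λ′ c →
  + hook λ′ r c ≡ beta λ′ r - (+ c - + colLen λ′ c)
hook-beta λ′ r c c< r< = begin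
  + hook λ′ r c                                                                 ≡⟨ ℤP.pos-+ (rowLen λ′ r ∸ suc c ℕ.+ (colLen λ′ c ∸ suc r)) 1 ⟩
  + (rowLen λ′ r ∸ suc c ℕ.+ (colLen λ′ c ∸ suc r)) ℤ.+ 1ℤ                       ≡⟨ cong (ℤ._+ 1ℤ) (ℤP.pos-+ (rowLen λ′ r ∸ suc c) (colLen λ′ c ∸ suc r)) ⟩
  + (rowLen λ′ r ∸ suc c) ℤ.+ + (colLen λ′ c ∸ suc r) ℤ.+ 1ℤ                     ≡⟨ cong₂ (λ u v → u ℤ.+ v ℤ.+ 1ℤ) (+-∸ c<) (+-∸ r<) ⟩
  + rowLen λ′ r - + suc c ℤ.+ (+ colLen λ′ c - + suc r) ℤ.+ 1ℤ                  ≡⟨ e (+ rowLen λ′ r) (+ c) (+ colLen λ′ c) (+ r) ⟩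
  + rowLen λ′ r - + suc r - (+ c - + colLen λ′ c)                               ≡⟨ cong (_- (+ c - + colLen λ′ c)) (sym (beta-def λ′ r)) ⟩
  beta λ′ r - (+ c - + colLen λ′ c)                                             ∎
  where
  open ≡-Reasoning
  e : ∀ R c K r → R - (1ℤ ℤ.+ c) ℤ.+ (K - (1ℤ ℤ.+ r)) ℤ.+ 1ℤ ≡ R - (1ℤ ℤ.+ r) - (c - K)
  e = solve-∀

beta≢column-gap : ∀ {λ′} → Linked ℕ._≥_ λ′ → ∀ c s → beta λ′ s ≢ + c - + colLen λ′ c
beta≢column-gap {λ′} L c s gap with s ℕ.<? colLen λ′ c
... | yes s<K = ℕP.m<n⇒n≢0 (ℕP.m<m+n _ (s≤s z≤n)) (ℤP.+-injective (begin
  + hook λ′ s c                            ≡⟨ hook-beta λ′ s c (<-colLen⇒<-rowLen L c s s<K) s<K ⟩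
  beta λ′ s - (+ c - + colLen λ′ c)        ≡⟨ cong (λ w → beta λ′ s - w) (sym gap) ⟩
  beta λ′ s - beta λ′ s                    ≡⟨ ℤP.+-inverseʳ (beta λ′ s) ⟩
  0ℤ                                       ∎))
  where open ≡-Reasoning
... | no s≮K = ℤP.<-irrefl gap (<-offset (c ∸ R ℕ.+ (s ∸ K)) gap-above)
  where
  K = colLen λ′ c
  R = rowLen λ′ s
  gap-above : + c - + K ≡ beta λ′ s ℤ.+ + suc (c ∸ R ℕ.+ (s ∸ K))
  gap-above = begin
    + c - + K                                                 ≡⟨ e (+ c) (+ K) (+ R) (+ s) ⟩
    (+ R - + suc s) ℤ.+ (1ℤ ℤ.+ ((+ c - + R) ℤ.+ (+ s - + K))) ≡⟨ cong₂ (λ u v → u ℤ.+ (1ℤ ℤ.+ v)) (sym (beta-def λ′ s)) (cong₂ ℤ._+_ (sym (+-∸ R≤c)) (sym (+-∸ K≤s))) ⟩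
    beta λ′ s ℤ.+ (1ℤ ℤ.+ (+ (c ∸ R) ℤ.+ + (s ∸ K)))           ≡⟨ cong (λ w → beta λ′ s ℤ.+ (1ℤ ℤ.+ w)) (sym (ℤP.pos-+ (c ∸ R) (s ∸ K))) ⟩
    beta λ′ s ℤ.+ + suc (c ∸ R ℕ.+ (s ∸ K))                   ∎
    where
    open ≡-Reasoning
    R≤c : R ℕ.≤ c
    R≤c = ℕP.≮⇒≥ (λ c<R → s≮K (<-rowLen⇒<-colLen L c s c<R))
    K≤s : K ℕ.≤ s
    K≤s = ℕP.≮⇒≥ s≮K
    e : ∀ c K R s → c - K ≡ R - (1ℤ ℤ.+ s) ℤ.+ (1ℤ ℤ.+ ((c - R) ℤ.+ (s - K)))
    e = solve-∀

first-beta-below : ∀ {λ′} → Linked ℕ._≥_ λ′ → ∀ y B → beta λ′ B ℤ.< y →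
  Σ ℕ λ k → (beta λ′ k ℤ.< y) × (∀ s → s ℕ.< k → y ℤ.≤ beta λ′ s)
first-beta-below L y zero lt = 0 , lt , λ s ()
first-beta-below {λ′} L y (suc B) lt with y ℤ.≤? beta λ′ B
... | yes y≤ = suc B , lt , λ s s<k → ℤP.≤-trans y≤ (beta-antitone L (ℕP.≤-pred s<k))
... | no y≰ = first-beta-below L y B (ℤP.≰⇒> y≰)

gap-column : ∀ {λ′} → Linked ℕ._≥_ λ′ → ∀ {k y} → beta λ′ (suc k) ℤ.< y → y ℤ.< beta λ′ k →
             Σ ℕ λ c → (+ c - + colLen λ′ c ≡ y) × colLen λ′ c ≡ suc k
gap-column {λ′} L {k} {y} below above = c , trans (cong (λ w → + c - + w) colLen-c) (foot (+ c) (+ k) (proj₂ W₁)) , colLen-c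
  where
  W₁ = <⇒offset (ℤP.≤-<-trans (beta-lower λ′ (suc k)) below)
  c = proj₁ W₁
  W₂ = <⇒offset above
  W₃ = <⇒offset below
  rowLen-k : rowLen λ′ k ≡ suc (c ℕ.+ proj₁ W₂)
  rowLen-k = ℤP.+-injective (trans (ar₁ (+ rowLen λ′ k) (+ k) (+ c) (+ proj₁ W₂) (beta-def λ′ k) (proj₂ W₂) (proj₂ W₁))
                          (cong (λ w → 1ℤ ℤ.+ w) (sym (ℤP.pos-+ c (proj₁ W₂)))))
    where
    ar₁ : ∀ R k c e {x y} → x ≡ R - (1ℤ ℤ.+ k) → x ≡ y ℤ.+ (1ℤ ℤ.+ e) → y ≡ - (1ℤ ℤ.+ (1ℤ ℤ.+ k)) ℤ.+ (1ℤ ℤ.+ c) → R ≡ 1ℤ ℤ.+ (c ℤ.+ e)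
    ar₁ R k c e refl h refl = ≡-by-difference h (id R k c e)
      where
      id : ∀ R k c e → R - (1ℤ ℤ.+ (c ℤ.+ e)) ≡ R - (1ℤ ℤ.+ k) - (- (1ℤ ℤ.+ (1ℤ ℤ.+ k)) ℤ.+ (1ℤ ℤ.+ c) ℤ.+ (1ℤ ℤ.+ e))
      id = solve-∀
  rowLen-suc-k≤c : rowLen λ′ (suc k) ℕ.≤ c
  rowLen-suc-k≤c = subst (rowLen λ′ (suc k) ℕ.≤_)
    (ℤP.+-injective (trans (ℤP.pos-+ (rowLen λ′ (suc k)) (proj₁ W₃))
      (ar₂ (+ rowLen λ′ (suc k)) (+ k) (+ c) (+ proj₁ W₃) (beta-def λ′ (suc k)) (proj₂ W₃) (proj₂ W₁))))
    (ℕP.m≤m+n _ _)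
    where
    ar₂ : ∀ R k c f {x y} → x ≡ R - (1ℤ ℤ.+ (1ℤ ℤ.+ k)) → y ≡ x ℤ.+ (1ℤ ℤ.+ f) → y ≡ - (1ℤ ℤ.+ (1ℤ ℤ.+ k)) ℤ.+ (1ℤ ℤ.+ c) → R ℤ.+ f ≡ c
    ar₂ R k c f refl h₁ h₂ = ≡-by-difference (trans (sym h₁) h₂) (id R k c f)
      where
      id : ∀ R k c f → R ℤ.+ f - c ≡ R - (1ℤ ℤ.+ (1ℤ ℤ.+ k)) ℤ.+ (1ℤ ℤ.+ f) - (- (1ℤ ℤ.+ (1ℤ ℤ.+ k)) ℤ.+ (1ℤ ℤ.+ c))
      id = solve-∀
  colLen-c : colLen λ′ c ≡ suc k
  colLen-c = colLen-≡ λ′ c (suc k)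
    (λ s s<k → ℕP.<-≤-trans (subst (c ℕ.<_) (sym rowLen-k) (s≤s (ℕP.m≤m+n c _))) (rowLen-antitone L (ℕP.≤-pred s<k)))
    (λ s k≤s → ℕP.≤-trans (rowLen-antitone L k≤s) rowLen-suc-k≤c)
  foot : ∀ c k {y} → y ≡ - (1ℤ ℤ.+ (1ℤ ℤ.+ k)) ℤ.+ (1ℤ ℤ.+ c) → c - (1ℤ ℤ.+ k) ≡ y
  foot c k refl = id c k
    where
    id : ∀ c k → c - (1ℤ ℤ.+ k) ≡ - (1ℤ ℤ.+ (1ℤ ℤ.+ k)) ℤ.+ (1ℤ ℤ.+ c)
    id = solve-∀

hook-at-gap : ∀ {λ′} → Linked ℕ._≥_ λ′ → ∀ {r k y} → r ℕ.≤ k →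
  beta λ′ (suc k) ℤ.< y → y ℤ.< beta λ′ k →
  Σ ℕ λ c → c ℕ.< rowLen λ′ r × + hook λ′ r c ≡ beta λ′ r - y
hook-at-gap {λ′} L {r} r≤k below above = c , box , trans (hook-beta λ′ r c box r<colLen) (cong (λ w → beta λ′ r - w) foot)
  where
  column = gap-column L below above
  c = proj₁ column
  foot = proj₁ (proj₂ column)
  r<colLen : r ℕ.< colLen λ′ c
  r<colLen = subst (r ℕ.<_) (sym (proj₂ (proj₂ column))) (s≤s r≤k)
  box : c ℕ.< rowLen λ′ r
  box = <-colLen⇒<-rowLen L c r r<colLen

rowLen-≡⇒beta-≡ : ∀ {λ′ μ} r → rowLen μ r ≡ rowLen λ′ r → beta μ r ≡ beta λ′ r
rowLen-≡⇒beta-≡ {λ′} {μ} r eq = trans (beta-def μ r) (trans (cong (λ w → + w - + suc r) eq) (sym (beta-def λ′ r)))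

rowLen-suc⇒beta-+1 : ∀ {λ′ μ} r → rowLen μ r ≡ suc (rowLen λ′ r) → beta μ r ≡ beta λ′ r ℤ.+ 1ℤ
rowLen-suc⇒beta-+1 {λ′} {μ} r eq = begin
  beta μ r                          ≡⟨ beta-def μ r ⟩
  + rowLen μ r - + suc r            ≡⟨ cong (λ w → + w - + suc r) eq ⟩
  + suc (rowLen λ′ r) - + suc r     ≡⟨ e (+ rowLen λ′ r) (+ r) ⟩
  + rowLen λ′ r - + suc r ℤ.+ 1ℤ    ≡⟨ cong (ℤ._+ 1ℤ) (sym (beta-def λ′ r)) ⟩
  beta λ′ r ℤ.+ 1ℤ                  ∎
  where
  open ≡-Reasoning
  e : ∀ R r → (1ℤ ℤ.+ R) - (1ℤ ℤ.+ r) ≡ R - (1ℤ ℤ.+ r) ℤ.+ 1ℤ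
  e = solve-∀

rowLen-row≡beta+1 : ∀ λ′ r → + rowLen λ′ r - + r ≡ beta λ′ r ℤ.+ 1ℤ
rowLen-row≡beta+1 λ′ r = trans (e (+ rowLen λ′ r) (+ r)) (cong (ℤ._+ 1ℤ) (sym (beta-def λ′ r)))
  where
  e : ∀ R r → R - r ≡ R - (1ℤ ℤ.+ r) ℤ.+ 1ℤ
  e = solve-∀

suc-rowLen-row≡beta+2 : ∀ λ′ r → + suc (rowLen λ′ r) - + r ≡ beta λ′ r ℤ.+ 1ℤ ℤ.+ 1ℤ
suc-rowLen-row≡beta+2 λ′ r = trans (e (+ rowLen λ′ r) (+ r)) (cong (λ w → w ℤ.+ 1ℤ ℤ.+ 1ℤ) (sym (beta-def λ′ r)))
  where
  e : ∀ R r → (1ℤ ℤ.+ R) - r ≡ R - (1ℤ ℤ.+ r) ℤ.+ 1ℤ ℤ.+ 1ℤ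
  e = solve-∀

equal-rows⇒beta-+1 : ∀ λ′ r → rowLen λ′ (suc r) ≡ rowLen λ′ r → beta λ′ r ≡ beta λ′ (suc r) ℤ.+ 1ℤ
equal-rows⇒beta-+1 λ′ r eq = trans (beta-def λ′ r) (trans (cong (λ w → + w - + suc r) (sym eq))
  (trans (e (+ rowLen λ′ (suc r)) (+ r)) (cong (ℤ._+ 1ℤ) (sym (beta-def λ′ (suc r))))))
  where
  e : ∀ R r → R - (1ℤ ℤ.+ r) ≡ R - (1ℤ ℤ.+ (1ℤ ℤ.+ r)) ℤ.+ 1ℤ
  e = solve-∀

step-rows⇒beta-+2 : ∀ λ′ r → suc (rowLen λ′ (suc r)) ≡ rowLen λ′ r → beta λ′ r ≡ beta λ′ (suc r) ℤ.+ 1ℤ ℤ.+ 1ℤ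
step-rows⇒beta-+2 λ′ r eq = trans (beta-def λ′ r) (trans (cong (λ w → + w - + suc r) (sym eq))
  (trans (e (+ rowLen λ′ (suc r)) (+ r)) (cong (λ w → w ℤ.+ 1ℤ ℤ.+ 1ℤ) (sym (beta-def λ′ (suc r))))))
  where
  e : ∀ R r → (1ℤ ℤ.+ R) - (1ℤ ℤ.+ r) ≡ R - (1ℤ ℤ.+ (1ℤ ℤ.+ r)) ℤ.+ 1ℤ ℤ.+ 1ℤ
  e = solve-∀

fromRows : (ℕ → ℕ) → ℕ → List ℕ
fromRows f zero = []
fromRows f (suc N) with f 0
... | zero = []
... | suc k = suc k ∷ fromRows (λ r → f (suc r)) N

Antitone : (ℕ → ℕ) → Set
Antitone f = ∀ r → f (suc r) ℕ.≤ f r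

antitone-≤-0 : ∀ f → Antitone f → ∀ r → f r ℕ.≤ f 0
antitone-≤-0 f d zero = ℕP.≤-refl
antitone-≤-0 f d (suc r) = ℕP.≤-trans (d r) (antitone-≤-0 f d r)

rowLen-fromRows : ∀ f N → Antitone f → (∀ r → N ℕ.≤ r → f r ≡ 0) → ∀ r → rowLen (fromRows f N) r ≡ f r
rowLen-fromRows f zero d z r = sym (z r z≤n)
rowLen-fromRows f (suc N) d z r with f 0 in e
... | zero = sym (ℕP.n≤0⇒n≡0 (subst (f r ℕ.≤_) e (antitone-≤-0 f d r)))
rowLen-fromRows f (suc N) d z zero | suc k = sym e
rowLen-fromRows f (suc N) d z (suc r) | suc k = rowLen-fromRows (λ r → f (suc r)) N (λ r → d (suc r)) (λ r le → z (suc r) (s≤s le)) r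

linked-∷ : ∀ h t → Linked ℕ._≥_ t → rowLen t 0 ℕ.≤ h → Linked ℕ._≥_ (h ∷ t)
linked-∷ h [] L le = [-]
linked-∷ h (h' ∷ t) L le = le ∷ L

fromRows-isPartition : ∀ f N → Antitone f → (∀ r → N ℕ.≤ r → f r ≡ 0) → IsPartition (fromRows f N)
fromRows-isPartition f zero d z = [] , []
fromRows-isPartition f (suc N) d z with f 0 in e
... | zero = [] , []
... | suc k = linked-∷ (suc k) _ (proj₁ IH) (subst₂ ℕ._≤_ (sym (rowLen-fromRows f' N d' z' 0)) e (d 0)) , (s≤s z≤n ∷ proj₂ IH)
  where
  f' = λ r → f (suc r)
  d' = λ r → d (suc r)
  z' = λ r (le : N ℕ.≤ r) → z (suc r) (s≤s le)
  IH = fromRows-isPartition f' N d' z'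

-- The abacus with A = suc m runners

module Abacus (m : ℕ) where

  A : ℕ
  A = suc m

  aℤ : ℤ
  aℤ = + A

  opaque
    cell : ℤ → Fin A → ℤ
    cell t ρ = aℤ ℤ.* t ℤ.+ + toℕ ρ

    cell-def : ∀ t ρ → cell t ρ ≡ aℤ ℤ.* t ℤ.+ + toℕ ρ
    cell-def t ρ = refl

    cell-< : ∀ {t t'} (ρ ρ' : Fin A) → t ℤ.< t' → cell t ρ ℤ.< cell t' ρ'
    cell-< {t} {t'} ρ ρ' t<t' = begin-strict
        aℤ ℤ.* t ℤ.+ + toℕ ρ   <⟨ ℤP.+-monoʳ-< (aℤ ℤ.* t) (+<+ (FinP.toℕ<n ρ)) ⟩
        aℤ ℤ.* t ℤ.+ aℤ        ≡⟨ e aℤ t ⟩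
        aℤ ℤ.* (t ℤ.+ 1ℤ)      ≤⟨ ℤP.*-monoˡ-≤-nonNeg aℤ (subst (ℤ._≤ t') (ℤP.+-comm 1ℤ t) (ℤP.i<j⇒suc[i]≤j t<t')) ⟩
        aℤ ℤ.* t'              ≤⟨ ℤP.i≤i+j (aℤ ℤ.* t') (+ toℕ ρ') ⟩
        aℤ ℤ.* t' ℤ.+ + toℕ ρ' ∎
      where
      open ℤP.≤-Reasoning
      e : ∀ a t → a ℤ.* t ℤ.+ a ≡ a ℤ.* (t ℤ.+ 1ℤ)
      e = solve-∀

    cell-injective : ∀ {t t' ρ ρ'} → cell t ρ ≡ cell t' ρ' → t ≡ t' × ρ ≡ ρ'
    cell-injective {t} {t'} {ρ} {ρ'} eq with ℤP.<-cmp t t'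
    ... | tri< lt _ _ = ⊥-elim (ℤP.<-irrefl eq (cell-< ρ ρ' lt))
    ... | tri> _ _ gt = ⊥-elim (ℤP.<-irrefl (sym eq) (cell-< ρ' ρ gt))
    ... | tri≈ _ refl _ = refl , FinP.toℕ-injective (ℤP.+-injective (+-cancelˡ-≡ (aℤ ℤ.* t) eq))

    cell-surjective : ∀ z → Σ ℤ λ t → Σ (Fin A) λ ρ → cell t ρ ≡ z
    cell-surjective z = z ℤ./ℕ A , fromℕ< (n%ℕd<d z A) , eq
      where
      eq : aℤ ℤ.* (z ℤ./ℕ A) ℤ.+ + toℕ (fromℕ< (n%ℕd<d z A)) ≡ z
      eq rewrite FinP.toℕ-fromℕ< (n%ℕd<d z A)
               | ℤP.*-comm aℤ (z ℤ./ℕ A)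
               | ℤP.+-comm ((z ℤ./ℕ A) ℤ.* aℤ) (+ (z ℤ.%ℕ A)) = sym (a≡a%ℕn+[a/ℕn]*n z A)

  level : ℤ → ℤ
  level z = proj₁ (cell-surjective z)

  runner : ℤ → Fin A
  runner z = proj₁ (proj₂ (cell-surjective z))

  cell-level-runner : ∀ z → cell (level z) (runner z) ≡ z
  cell-level-runner z = proj₂ (proj₂ (cell-surjective z))

  level-cell : ∀ t ρ → level (cell t ρ) ≡ t
  level-cell t ρ = proj₁ (cell-injective (cell-level-runner (cell t ρ)))

  runner-cell : ∀ t ρ → runner (cell t ρ) ≡ ρ
  runner-cell t ρ = proj₂ (cell-injective (cell-level-runner (cell t ρ)))

  cell-of-runner : ∀ z {ρ} → runner z ≡ ρ → z ≡ cell (level z) ρ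
  cell-of-runner z eq = trans (sym (cell-level-runner z)) (cong (cell (level z)) eq)

  runner-level-of : ∀ {z t ρ} → z ≡ cell t ρ → runner z ≡ ρ × level z ≡ t
  runner-level-of {t = t} {ρ} refl = runner-cell t ρ , level-cell t ρ

  ∣⇒runner : ∀ {z ρ} → aℤ ℤ∣.∣ z - + toℕ ρ → runner z ≡ ρ
  ∣⇒runner {z} {ρ} (ℤ∣.divides q eq) = proj₁ (runner-level-of (begin
    z                          ≡⟨ sym (i-j+j≡i z (+ toℕ ρ)) ⟩
    z - + toℕ ρ ℤ.+ + toℕ ρ    ≡⟨ cong (λ w → w ℤ.+ + toℕ ρ) (trans eq (ℤP.*-comm q aℤ)) ⟩
    aℤ ℤ.* q ℤ.+ + toℕ ρ       ≡⟨ sym (cell-def q ρ) ⟩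
    cell q ρ                   ∎))
    where open ≡-Reasoning

  runner⇒∣ : ∀ {z ρ} → runner z ≡ ρ → aℤ ℤ∣.∣ z - + toℕ ρ
  runner⇒∣ {z} {ρ} eq = ℤ∣.divides (level z) (begin
    z - + toℕ ρ                             ≡⟨ cong (_- + toℕ ρ) (trans (cell-of-runner z eq) (cell-def (level z) ρ)) ⟩
    aℤ ℤ.* level z ℤ.+ + toℕ ρ - + toℕ ρ    ≡⟨ i+j-j≡i (aℤ ℤ.* level z) (+ toℕ ρ) ⟩
    aℤ ℤ.* level z                          ≡⟨ ℤP.*-comm aℤ (level z) ⟩
    level z ℤ.* aℤ                          ∎)
    where open ≡-Reasoning

  cell-shift-level : ∀ t c ρ → cell t ρ - aℤ ℤ.* c ≡ cell (t - c) ρ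
  cell-shift-level t c ρ = trans (cong (_- aℤ ℤ.* c) (cell-def t ρ)) (trans (e aℤ t c (+ toℕ ρ)) (sym (cell-def (t - c) ρ)))
    where
    e : ∀ a t c r → a ℤ.* t ℤ.+ r - a ℤ.* c ≡ a ℤ.* (t - c) ℤ.+ r
    e = solve-∀

  cell-pred-level : ∀ t ρ → cell t ρ - aℤ ≡ cell (t - 1ℤ) ρ
  cell-pred-level t ρ = trans (cong (λ w → cell t ρ - w) (sym (ℤP.*-identityʳ aℤ))) (cell-shift-level t 1ℤ ρ)

  cell-<-lex : ∀ {t t' ρ ρ'} → cell t ρ ℤ.< cell t' ρ' → t ℤ.< t' ⊎ (t ≡ t' × toℕ ρ ℕ.< toℕ ρ')
  cell-<-lex {t} {t'} {ρ} {ρ'} lt with ℤP.<-cmp t t'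
  ... | tri< a _ _ = inj₁ a
  ... | tri> _ _ c = ⊥-elim (ℤP.<-asym lt (cell-< ρ' ρ c))
  ... | tri≈ _ refl _ = inj₂ (refl , ℤP.drop‿+<+ (+-cancelˡ-< (aℤ ℤ.* t) (subst₂ ℤ._<_ (cell-def t ρ) (cell-def t ρ') lt)))

  cell-<-lex⇐ : ∀ {t ρ ρ'} → toℕ ρ ℕ.< toℕ ρ' → cell t ρ ℤ.< cell t ρ'
  cell-<-lex⇐ {t} {ρ} {ρ'} lt = subst₂ ℤ._<_ (sym (cell-def t ρ)) (sym (cell-def t ρ')) (ℤP.+-monoʳ-< (aℤ ℤ.* t) (+<+ lt))

  cell-nonneg : ∀ t ρ → 0ℤ ℤ.≤ t → 0ℤ ℤ.≤ cell t ρ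
  cell-nonneg t ρ h = subst (0ℤ ℤ.≤_) (sym (cell-def t ρ))
    (ℤP.+-mono-≤ (subst (ℤ._≤ aℤ ℤ.* t) (ℤP.*-zeroʳ aℤ) (ℤP.*-monoˡ-≤-nonNeg aℤ h)) (+≤+ z≤n))

  neg⇒level-neg : ∀ z → z ℤ.< 0ℤ → level z ℤ.< 0ℤ
  neg⇒level-neg z lt = ℤP.≰⇒> λ 0≤level →
    ℤP.<⇒≱ lt (subst (0ℤ ℤ.≤_) (cell-level-runner z) (cell-nonneg (level z) (runner z) 0≤level))

  level-neg⇒neg : ∀ z → level z ℤ.< 0ℤ → z ℤ.< 0ℤ
  level-neg⇒neg z l = subst₂ ℤ._<_ (cell-level-runner z) cell-0-0 (cell-< (runner z) Fin.zero l)
    where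
    cell-0-0 : cell 0ℤ Fin.zero ≡ 0ℤ
    cell-0-0 = trans (cell-def 0ℤ Fin.zero) (trans (ℤP.+-identityʳ (aℤ ℤ.* 0ℤ)) (ℤP.*-zeroʳ aℤ))

-- a-cores are the partitions whose bead set is closed under z ↦ z - a

module Cores (m : ℕ) where
  open Abacus m

  Closed : List ℕ → Set
  Closed λ′ = ∀ z → Bead λ′ z → Bead λ′ (z - aℤ)

  closed-iterate : ∀ {λ′} → Closed λ′ → ∀ q {z} → Bead λ′ z → Bead λ′ (z - aℤ ℤ.* + q)
  closed-iterate cl zero {z} (r , eq) = r , trans eq (e aℤ z)
    where
    e : ∀ a z → z ≡ z - a ℤ.* 0ℤ
    e = solve-∀
  closed-iterate cl (suc q) {z} b with cl _ (closed-iterate cl q b)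
  ... | r , eq = r , trans eq (e aℤ z (+ q))
    where
    e : ∀ a z q → z - a ℤ.* q - a ≡ z - a ℤ.* (1ℤ ℤ.+ q)
    e = solve-∀

  closed-lower : ∀ {μ} → Closed μ → ∀ {T T' ρ} → T' ℤ.≤ T → Bead μ (cell T ρ) → Bead μ (cell T' ρ)
  closed-lower cl {T} {T'} {ρ} le b with ≤⇒offset le
  ... | d , refl = subst (Bead _) (trans (cell-shift-level (T' ℤ.+ + d) (+ d) ρ) (cong (λ t → cell t ρ) (e T' (+ d))))
                         (closed-iterate cl d b)
    where
    e : ∀ t d → t ℤ.+ d - d ≡ t
    e = solve-∀

  closed⇒core : ∀ {λ′} → IsPartition λ′ → Closed λ′ → IsCore A λ′
  closed⇒core {λ′} P@(L , _) cl = P , no-hook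
    where
    no-hook : ∀ r c → InBox λ′ r c → ¬ (A ∣ hook λ′ r c)
    no-hook r c box (divides q hook≡qA) = beta≢column-gap L c s (trans beta-s≡ lands-in-gap)
      where
      open ≡-Reasoning
      b = closed-iterate cl q (r , refl)
      s = proj₁ b
      beta-s≡ = proj₂ b
      lands-in-gap : beta λ′ r - aℤ ℤ.* + q ≡ + c - + colLen λ′ c
      lands-in-gap = begin
        beta λ′ r - aℤ ℤ.* + q                        ≡⟨ cong (λ w → beta λ′ r - w) (trans (ℤP.*-comm aℤ (+ q)) (sym (ℤP.pos-* q A))) ⟩
        beta λ′ r - + (q ℕ.* A)                       ≡⟨ cong (λ w → beta λ′ r - + w) (sym hook≡qA) ⟩
        beta λ′ r - + hook λ′ r c                     ≡⟨ cong (λ w → beta λ′ r - w) (hook-beta λ′ r c box (<-rowLen⇒<-colLen L c r box)) ⟩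
        beta λ′ r - (beta λ′ r - (+ c - + colLen λ′ c)) ≡⟨ e (beta λ′ r) (+ c - + colLen λ′ c) ⟩
        + c - + colLen λ′ c                           ∎
        where
        e : ∀ u y → u - (u - y) ≡ y
        e = solve-∀

  core⇒closed : ∀ {λ′} → IsCore A λ′ → Closed λ′
  core⇒closed {λ′} ((L , _) , no-hook) _ (r , refl) = search (first-beta-below L y N beta-N<y)
    where
    y = beta λ′ r - aℤ
    y<beta-r : y ℤ.< beta λ′ r
    y<beta-r = <-offset m (e (beta λ′ r) aℤ)
      where
      e : ∀ z a → z ≡ z - a ℤ.+ a
      e = solve-∀
    N = length λ′ ℕ.+ ℤ.∣ y ∣
    beta-N<y : beta λ′ N ℤ.< y
    beta-N<y = beta-far λ′ y (ℕP.m≤m+n _ _) (ℕP.m≤n+m _ _)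
    search : (Σ ℕ λ k → (beta λ′ k ℤ.< y) × (∀ s → s ℕ.< k → y ℤ.≤ beta λ′ s)) → Bead λ′ y
    search (zero , below , _) = ⊥-elim (ℤP.<-asym below (ℤP.<-≤-trans y<beta-r (beta-antitone L z≤n)))
    search (suc k , below , above) with beta λ′ k ℤ.≟ y
    ... | yes eq = k , eq
    ... | no ne = ⊥-elim (no-hook r c box (subst (A ∣_) (sym hook≡A) ∣-refl))
      where
      r≤k : r ℕ.≤ k
      r≤k = ℕP.≮⇒≥ λ k<r → ℤP.<-asym (ℤP.≤-<-trans (beta-antitone L k<r) below) y<beta-r
      gap = hook-at-gap L r≤k below (ℤP.≤∧≢⇒< (above k ℕP.≤-refl) (λ e → ne (sym e)))
      c = proj₁ gap
      box = proj₁ (proj₂ gap)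
      hook≡A : hook λ′ r c ≡ A
      hook≡A = ℤP.+-injective (trans (proj₂ (proj₂ gap)) (e (beta λ′ r) aℤ))
        where
        e : ∀ z a → z - (z - a) ≡ a
        e = solve-∀

-- s_i exchanges runners prev i = i - 1 and i; for i = 0 the runner a - 1
-- sits one level lower, which wrap records.
module Runners (n : ℕ) where
  open Abacus (suc n) public
  open Cores (suc n) public

  prev : Fin A → Fin A
  prev Fin.zero    = fromℕ (suc n)
  prev (Fin.suc l) = inject₁ l

  wrap : Fin A → ℤ
  wrap Fin.zero    = 1ℤ
  wrap (Fin.suc l) = 0ℤ

  prev≢ : ∀ i → prev i ≢ i
  prev≢ Fin.zero ()
  prev≢ (Fin.suc l) eq = ℕP.<⇒≢ (ℕP.n<1+n (toℕ l)) (trans (sym (FinP.toℕ-inject₁ l)) (cong toℕ eq))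

  cell-prev-+1 : ∀ i t → cell t (prev i) ℤ.+ 1ℤ ≡ cell (t ℤ.+ wrap i) i
  cell-prev-+1 Fin.zero t rewrite cell-def t (prev Fin.zero) | cell-def (t ℤ.+ 1ℤ) Fin.zero | FinP.toℕ-fromℕ (suc n) = e (+ suc n) t
    where
    e : ∀ m t → (1ℤ ℤ.+ m) ℤ.* t ℤ.+ m ℤ.+ 1ℤ ≡ (1ℤ ℤ.+ m) ℤ.* (t ℤ.+ 1ℤ) ℤ.+ 0ℤ
    e = solve-∀
  cell-prev-+1 (Fin.suc l) t rewrite cell-def t (prev (Fin.suc l)) | cell-def (t ℤ.+ 0ℤ) (Fin.suc l) | FinP.toℕ-inject₁ l = e aℤ t (+ toℕ l)
    where
    e : ∀ a t m → a ℤ.* t ℤ.+ m ℤ.+ 1ℤ ≡ a ℤ.* (t ℤ.+ 0ℤ) ℤ.+ (1ℤ ℤ.+ m)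
    e = solve-∀

  cell-current-1 : ∀ i t → cell t i - 1ℤ ≡ cell (t - wrap i) (prev i)
  cell-current-1 i t = begin
    cell t i - 1ℤ                           ≡⟨ cong (λ w → cell w i - 1ℤ) (sym (i-j+j≡i t (wrap i))) ⟩
    cell (t - wrap i ℤ.+ wrap i) i - 1ℤ     ≡⟨ cong (_- 1ℤ) (sym (cell-prev-+1 i (t - wrap i))) ⟩
    cell (t - wrap i) (prev i) ℤ.+ 1ℤ - 1ℤ  ≡⟨ i+1-1≡i _ ⟩
    cell (t - wrap i) (prev i)              ∎
    where open ≡-Reasoning

  next-of-prev : ∀ i z → runner z ≡ prev i → runner (z ℤ.+ 1ℤ) ≡ i × level (z ℤ.+ 1ℤ) ≡ level z ℤ.+ wrap i
  next-of-prev i z eq = runner-level-of (trans (cong (ℤ._+ 1ℤ) (cell-of-runner z eq)) (cell-prev-+1 i (level z)))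

  prev-of-current : ∀ i z → runner z ≡ i → runner (z - 1ℤ) ≡ prev i × level (z - 1ℤ) ≡ level z - wrap i
  prev-of-current i z eq = runner-level-of (trans (cong (_- 1ℤ) (cell-of-runner z eq)) (cell-current-1 i (level z)))

  prev-of-next : ∀ i z → runner (z ℤ.+ 1ℤ) ≡ i → runner z ≡ prev i
  prev-of-next i z eq = subst (λ w → runner w ≡ prev i) (i+1-1≡i z) (proj₁ (prev-of-current i (z ℤ.+ 1ℤ) eq))

  current-twice-absurd : ∀ i z → runner z ≡ i → runner (z ℤ.+ 1ℤ) ≡ i → ⊥
  current-twice-absurd i z e₁ e₂ = prev≢ i (trans (sym (prev-of-next i z e₂)) e₁)

-- Cores as runner heights, and the uniqueness of s_i λ

module Action (n : ℕ) where
  open Runners n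

  Occupied : (Fin A → ℤ) → ℤ → Set
  Occupied ν z = level z ℤ.< ν (runner z)

  occupied? : ∀ ν z → Dec (Occupied ν z)
  occupied? ν z = level z ℤ.<? ν (runner z)

  -- The beads of an a-core fill each runner ρ exactly below level ν ρ; these
  -- heights are the translation part of the affine element producing the core.
  Heights : List ℕ → (Fin A → ℤ) → Set
  Heights λ′ ν = ∀ z → (Bead λ′ z → Occupied ν z) × (Occupied ν z → Bead λ′ z)

  occupied-cell⇐ : ∀ ν t ρ → t ℤ.< ν ρ → Occupied ν (cell t ρ)
  occupied-cell⇐ ν t ρ h = subst₂ (λ a b → a ℤ.< ν b) (sym (level-cell t ρ)) (sym (runner-cell t ρ)) h

  occupied-on : ∀ {ν z ρ} → runner z ≡ ρ → Occupied ν z → level z ℤ.< ν ρ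
  occupied-on {ν} eq h = subst (λ ρ → _ ℤ.< ν ρ) eq h

  occupied-on⇐ : ∀ {ν z ρ} → runner z ≡ ρ → level z ℤ.< ν ρ → Occupied ν z
  occupied-on⇐ {ν} eq h = subst (λ ρ → _ ℤ.< ν ρ) (sym eq) h

  content⇒runner : ∀ {r c i} → Content A r c i → runner (+ c - + r) ≡ i
  content⇒runner ct = ∣⇒runner (ℤ∣.∣ᵤ⇒∣ ct)

  runner⇒content : ∀ {r c i} → runner (+ c - + r) ≡ i → Content A r c i
  runner⇒content eq = ℤ∣.∣⇒∣ᵤ (runner⇒∣ eq)

  diffOnly-sym : ∀ {i λ′ μ} → DiffOnly A i λ′ μ → DiffOnly A i μ λ′
  diffOnly-sym dif r c nc = ⇔.sym (dif r c nc)

  data Shift : Set where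
    down stay up : Shift

  shiftℤ : Shift → ℤ
  shiftℤ down = -1ℤ
  shiftℤ stay = 0ℤ
  shiftℤ up = 1ℤ

  shift≡stay : ∀ {d} → d ≢ up → d ≢ down → d ≡ stay
  shift≡stay {down} _ nd = ⊥-elim (nd refl)
  shift≡stay {stay} _ _ = refl
  shift≡stay {up} nu _ = ⊥-elim (nu refl)

  <-shift⇒up : ∀ w d → w ℤ.< w ℤ.+ shiftℤ d → d ≡ up
  <-shift⇒up w down lt = ⊥-elim (ℤP.<-asym lt (<-offset 0 (e w)))
    where
    e : ∀ w → w ≡ w ℤ.+ -1ℤ ℤ.+ 1ℤ
    e = solve-∀
  <-shift⇒up w stay lt = ⊥-elim (ℤP.<-irrefl (sym (ℤP.+-identityʳ w)) lt)
  <-shift⇒up w up lt = refl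

  shift-<⇒down : ∀ w d → w ℤ.+ shiftℤ d ℤ.< w → d ≡ down
  shift-<⇒down w down lt = refl
  shift-<⇒down w stay lt = ⊥-elim (ℤP.<-irrefl (ℤP.+-identityʳ w) lt)
  shift-<⇒down w up lt = ⊥-elim (ℤP.<-asym lt (<-offset 0 refl))

  module _ (i : Fin A) where
    private
      p = prev i
      s = wrap i

    -- Changing boxes of content i only moves each bead by at most one step,
    -- from runner p up to runner i or back.
    RowShift : List ℕ → List ℕ → (ℕ → Shift) → Set
    RowShift λ′ μ δ = (∀ r → beta μ r ≡ beta λ′ r ℤ.+ shiftℤ (δ r)) ×
                      (∀ r → δ r ≡ up → runner (beta λ′ r) ≡ p) ×
                      (∀ r → δ r ≡ down → runner (beta λ′ r) ≡ i)

    added-box-content : ∀ {λ′ μ} → DiffOnly A i λ′ μ → ∀ r c → c ℕ.< rowLen μ r → ¬ c ℕ.< rowLen λ′ r → runner (+ c - + r) ≡ i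
    added-box-content dif r c inμ notλ with runner (+ c - + r) Fin.≟ i
    ... | yes e = e
    ... | no ne = ⊥-elim (notλ (Equivalence.from (dif r c (λ ct → ne (content⇒runner {r} {c} {i} ct))) inμ))

    grown-row : ∀ {λ′ μ} → DiffOnly A i λ′ μ → ∀ r → rowLen λ′ r ℕ.< rowLen μ r →
                rowLen μ r ≡ suc (rowLen λ′ r) × runner (beta λ′ r ℤ.+ 1ℤ) ≡ i
    grown-row {λ′} {μ} dif r gt = M≡ , c₁
      where
      R = rowLen λ′ r
      c₁ : runner (beta λ′ r ℤ.+ 1ℤ) ≡ i
      c₁ = subst (λ w → runner w ≡ i) (rowLen-row≡beta+1 λ′ r) (added-box-content {λ′} {μ} dif r R gt (ℕP.<-irrefl refl))
      M≡ : rowLen μ r ≡ suc R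
      M≡ with ℕP.<-cmp (suc R) (rowLen μ r)
      ... | tri≈ _ e _ = sym e
      ... | tri> _ _ lt = ⊥-elim (ℕP.<-irrefl refl (ℕP.<-≤-trans lt gt))
      ... | tri< lt _ _ = ⊥-elim (current-twice-absurd i (beta λ′ r ℤ.+ 1ℤ) c₁
               (subst (λ w → runner w ≡ i) (suc-rowLen-row≡beta+2 λ′ r) (added-box-content {λ′} {μ} dif r (suc R) lt (ℕP.<-asym (ℕP.n<1+n R)))))

    row-shift : ∀ {λ′ μ} → DiffOnly A i λ′ μ → ∀ r → Σ Shift λ d →
      (beta μ r ≡ beta λ′ r ℤ.+ shiftℤ d) × (d ≡ up → runner (beta λ′ r) ≡ p) × (d ≡ down → runner (beta λ′ r) ≡ i)
    row-shift {λ′} {μ} dif r with ℕP.<-cmp (rowLen μ r) (rowLen λ′ r)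
    ... | tri≈ _ eq _ = stay , trans (rowLen-≡⇒beta-≡ {λ′} {μ} r eq) (sym (ℤP.+-identityʳ _)) , (λ ()) , (λ ())
    ... | tri> _ _ gt = up , rowLen-suc⇒beta-+1 {λ′} {μ} r (proj₁ grown) , (λ _ → prev-of-next i _ (proj₂ grown)) , (λ ())
      where
      grown = grown-row {λ′} {μ} dif r gt
    ... | tri< lt _ _ = down , trans (sym (i+1-1≡i (beta μ r))) (cong (_- 1ℤ) (sym beta-λ)) , (λ ()) , (λ _ → trans (cong runner beta-λ) (proj₂ shrunk))
      where
      shrunk = grown-row {μ} {λ′} (diffOnly-sym {i} {λ′} {μ} dif) r lt
      beta-λ : beta λ′ r ≡ beta μ r ℤ.+ 1ℤ
      beta-λ = rowLen-suc⇒beta-+1 {μ} {λ′} r (proj₁ shrunk)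

    rowShift-of-diffOnly : ∀ {λ′ μ} → DiffOnly A i λ′ μ → Σ (ℕ → Shift) (RowShift λ′ μ)
    rowShift-of-diffOnly {λ′} {μ} dif = (λ r → proj₁ (shift r)) , (λ r → proj₁ (proj₂ (shift r))) ,
                                     (λ r → proj₁ (proj₂ (proj₂ (shift r)))) , (λ r → proj₂ (proj₂ (proj₂ (shift r))))
      where
      shift = row-shift {λ′} {μ} dif

    CanMoveUp : List ℕ → (Fin A → ℤ) → ℕ → Set
    CanMoveUp λ′ ν r = runner (beta λ′ r) ≡ p × ¬ Occupied ν (beta λ′ r ℤ.+ 1ℤ)

    CanMoveDown : List ℕ → (Fin A → ℤ) → ℕ → Set
    CanMoveDown λ′ ν r = runner (beta λ′ r) ≡ i × ¬ Occupied ν (beta λ′ r - 1ℤ)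

    canMoveUp? : ∀ λ′ ν r → Dec (CanMoveUp λ′ ν r)
    canMoveUp? λ′ ν r = (runner (beta λ′ r) Fin.≟ p) ×-dec ¬? (occupied? ν (beta λ′ r ℤ.+ 1ℤ))

    canMoveDown? : ∀ λ′ ν r → Dec (CanMoveDown λ′ ν r)
    canMoveDown? λ′ ν r = (runner (beta λ′ r) Fin.≟ i) ×-dec ¬? (occupied? ν (beta λ′ r - 1ℤ))

    canonicalShift : List ℕ → (Fin A → ℤ) → ℕ → Shift
    canonicalShift λ′ ν r with canMoveUp? λ′ ν r | canMoveDown? λ′ ν r
    ... | yes _ | _ = up
    ... | no _ | yes _ = down
    ... | no _ | no _ = stay

    occupied-next : ∀ {ν z} → runner z ≡ p → Occupied ν (z ℤ.+ 1ℤ) → level z ℤ.+ s ℤ.< ν i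
    occupied-next {ν} {z} eq h = subst (ℤ._< ν i) (proj₂ (next-of-prev i z eq)) (occupied-on {ν} (proj₁ (next-of-prev i z eq)) h)

    occupied-next⇐ : ∀ {ν z} → runner z ≡ p → level z ℤ.+ s ℤ.< ν i → Occupied ν (z ℤ.+ 1ℤ)
    occupied-next⇐ {ν} {z} eq h = occupied-on⇐ {ν} (proj₁ (next-of-prev i z eq)) (subst (ℤ._< ν i) (sym (proj₂ (next-of-prev i z eq))) h)

    occupied-pred : ∀ {ν z} → runner z ≡ i → Occupied ν (z - 1ℤ) → level z - s ℤ.< ν p
    occupied-pred {ν} {z} eq h = subst (ℤ._< ν p) (proj₂ (prev-of-current i z eq)) (occupied-on {ν} (proj₁ (prev-of-current i z eq)) h)

    occupied-pred⇐ : ∀ {ν z} → runner z ≡ i → level z - s ℤ.< ν p → Occupied ν (z - 1ℤ)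
    occupied-pred⇐ {ν} {z} eq h = occupied-on⇐ {ν} (proj₁ (prev-of-current i z eq)) (subst (ℤ._< ν p) (sym (proj₂ (prev-of-current i z eq))) h)

    -- A movable bead on runner p sits at level ≥ ν i - s, one on runner i at
    -- level ≥ ν p + s; both cannot happen below the heights.
    ¬up∧down : ∀ {λ′ ν} → Heights λ′ ν → ∀ {r₁ r₂} → CanMoveUp λ′ ν r₁ → CanMoveDown λ′ ν r₂ → ⊥
    ¬up∧down {λ′} {ν} H {r₁} {r₂} (rp₁ , free₁) (ri₂ , free₂) = ℤP.<-irrefl refl (begin-strict
      ν i              ≤⟨ νi≤t₁+s ⟩
      t₁ ℤ.+ s         <⟨ ℤP.+-monoˡ-< s t₁<νp ⟩
      ν p ℤ.+ s        ≤⟨ i≤j-k⇒i+k≤j νp≤t₂-s ⟩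
      t₂               <⟨ t₂<νi ⟩
      ν i              ∎)
      where
      open ℤP.≤-Reasoning
      t₁ = level (beta λ′ r₁)
      t₂ = level (beta λ′ r₂)
      t₁<νp : t₁ ℤ.< ν p
      t₁<νp = occupied-on {ν} rp₁ (proj₁ (H _) (r₁ , refl))
      t₂<νi : t₂ ℤ.< ν i
      t₂<νi = occupied-on {ν} ri₂ (proj₁ (H _) (r₂ , refl))
      νi≤t₁+s : ν i ℤ.≤ t₁ ℤ.+ s
      νi≤t₁+s = ℤP.≮⇒≥ (λ lt → free₁ (occupied-next⇐ {ν} rp₁ lt))
      νp≤t₂-s : ν p ℤ.≤ t₂ - s
      νp≤t₂-s = ℤP.≮⇒≥ (λ lt → free₂ (occupied-pred⇐ {ν} ri₂ lt))

    module RowShiftFacts {λ′ μ : List ℕ} (Lλ : Linked ℕ._≥_ λ′) (Lμ : Linked ℕ._≥_ μ) {δ : ℕ → Shift} (RS : RowShift λ′ μ δ) where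
      private
        beta-shift = proj₁ RS
        up-on-prev = proj₁ (proj₂ RS)
        down-on-current = proj₂ (proj₂ RS)

      beta-stay : ∀ {r} → δ r ≡ stay → beta μ r ≡ beta λ′ r
      beta-stay {r} e = trans (beta-shift r) (trans (cong (λ d → beta λ′ r ℤ.+ shiftℤ d) e) (ℤP.+-identityʳ _))

      beta-up : ∀ {r} → δ r ≡ up → beta μ r ≡ beta λ′ r ℤ.+ 1ℤ
      beta-up {r} e = trans (beta-shift r) (cong (λ d → beta λ′ r ℤ.+ shiftℤ d) e)

      beta-down : ∀ {r} → δ r ≡ down → beta μ r ≡ beta λ′ r - 1ℤ
      beta-down {r} e = trans (beta-shift r) (cong (λ d → beta λ′ r ℤ.+ shiftℤ d) e)

      all-stay⇒≡ : IsPartition λ′ → IsPartition μ → (∀ r → δ r ≡ stay) → μ ≡ λ′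
      all-stay⇒≡ Pλ Pμ all-stay = beta-≡⇒≡ Pλ Pμ (λ r → beta-stay (all-stay r))

      beta-<⇒row-> : ∀ {r r'} → beta λ′ r ℤ.< beta λ′ r' → r' ℕ.< r
      beta-<⇒row-> lt = ℕP.≰⇒> (λ r≤r' → ℤP.<⇒≱ lt (beta-antitone Lλ r≤r'))

      -- Beads keep their order, so the bead just above one moving up moves up too,
      -- which is impossible as both would be on runner p.
      up-gap : ∀ r → δ r ≡ up → ∀ r' → beta λ′ r' ≢ beta λ′ r ℤ.+ 1ℤ
      up-gap r e r' e' = prev≢ i (trans (sym (up-on-prev r' dr')) (trans (cong runner e') (proj₁ (next-of-prev i _ (up-on-prev r e)))))
        where
        r'<r : r' ℕ.< r
        r'<r = beta-<⇒row-> (subst (beta λ′ r ℤ.<_) (sym e') (<-offset 0 refl))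
        dr' : δ r' ≡ up
        dr' = <-shift⇒up _ _ (subst₂ ℤ._<_ (trans (beta-up e) (sym e')) (beta-shift r') (beta-strict Lμ r'<r))

      down-gap : ∀ r → δ r ≡ down → ∀ r' → beta λ′ r' ≢ beta λ′ r - 1ℤ
      down-gap r e r' e' = prev≢ i (trans (sym (proj₁ (prev-of-current i _ (down-on-current r e)))) (trans (cong runner (sym e')) (down-on-current r' dr')))
        where
        r<r' : r ℕ.< r'
        r<r' = beta-<⇒row-> (subst (ℤ._< beta λ′ r) (sym e') (<-offset 0 (sym (i-1+1≡i _))))
        dr' : δ r' ≡ down
        dr' = shift-<⇒down _ _ (subst₂ ℤ._<_ (beta-shift r') (trans (beta-down e) (sym e')) (beta-strict Lμ r<r'))

      module WithHeights {ν} (H : Heights λ′ ν) where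
        up⇒canMoveUp : ∀ {r} → δ r ≡ up → CanMoveUp λ′ ν r
        up⇒canMoveUp {r} e = up-on-prev r e , λ h → let b = proj₂ (H _) h in up-gap r e (proj₁ b) (proj₂ b)

        down⇒canMoveDown : ∀ {r} → δ r ≡ down → CanMoveDown λ′ ν r
        down⇒canMoveDown {r} e = down-on-current r e , λ h → let b = proj₂ (H _) h in down-gap r e (proj₁ b) (proj₂ b)

        up-target-lower : ∀ {r₂} → CanMoveUp λ′ ν r₂ → ∀ r' → beta μ r' ≡ beta λ′ r₂ ℤ.+ 1ℤ → δ r₂ ≡ up
        up-target-lower {r₂} (rp₂ , free₂) r' eq' with δ r' in dr'
        ... | stay = ⊥-elim (free₂ (proj₁ (H _) (r' , trans (sym (beta-stay dr')) eq')))
        ... | up = subst (λ r → δ r ≡ up) (beta-injective Lλ (+1-injective (trans (sym (beta-up dr')) eq'))) dr'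
        ... | down = ⊥-elim (prev≢ i (trans (sym (proj₁ (prev-of-current i _ (down-on-current r' dr'))))
                     (trans (cong runner (trans (sym (beta-down dr')) eq')) (proj₁ (next-of-prev i _ rp₂)))))

        up-target-same : ∀ {r₁} → CanMoveUp λ′ ν r₁ → δ r₁ ≡ up → ∀ r' → beta μ r' ≢ beta λ′ r₁
        up-target-same {r₁} (rp₁ , free₁) d₁ r' eq' with δ r' in dr'
        ... | stay = stay≢up (trans (sym dr') (trans (cong δ (beta-injective Lλ (trans (sym (beta-stay dr')) eq'))) d₁))
          where
          stay≢up : stay ≢ up
          stay≢up ()
        ... | up = prev≢ i (trans (sym rp₁) (trans (cong runner (sym (trans (sym (beta-up dr')) eq'))) (proj₁ (next-of-prev i _ (up-on-prev r' dr')))))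
        ... | down = free₁ (proj₁ (H _) (r' , -1≡⇒≡+1 (trans (sym (beta-down dr')) eq')))

        down-target-higher : ∀ {r₂} → CanMoveDown λ′ ν r₂ → ∀ r' → beta μ r' ≡ beta λ′ r₂ - 1ℤ → δ r₂ ≡ down
        down-target-higher {r₂} (ri₂ , free₂) r' eq' with δ r' in dr'
        ... | stay = ⊥-elim (free₂ (proj₁ (H _) (r' , trans (sym (beta-stay dr')) eq')))
        ... | down = subst (λ r → δ r ≡ down) (beta-injective Lλ (-1-injective (trans (sym (beta-down dr')) eq'))) dr'
        ... | up = ⊥-elim (prev≢ i (trans (sym (proj₁ (prev-of-current i _ ri₂)))
                     (trans (cong runner (trans (sym eq') (beta-up dr'))) (proj₁ (next-of-prev i _ (up-on-prev r' dr'))))))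

        down-target-same : ∀ {r₁} → CanMoveDown λ′ ν r₁ → δ r₁ ≡ down → ∀ r' → beta μ r' ≢ beta λ′ r₁
        down-target-same {r₁} (ri₁ , free₁) d₁ r' eq' with δ r' in dr'
        ... | stay = stay≢down (trans (sym dr') (trans (cong δ (beta-injective Lλ (trans (sym (beta-stay dr')) eq'))) d₁))
          where
          stay≢down : stay ≢ down
          stay≢down ()
        ... | up = free₁ (proj₁ (H _) (r' , +1≡⇒≡-1 (trans (sym (beta-up dr')) eq')))
        ... | down = prev≢ i (trans (sym (proj₁ (prev-of-current i _ (down-on-current r' dr')))) (trans (cong runner (trans (sym (beta-down dr')) eq')) ri₁))

        -- If μ is a core, moving one movable bead up forces every movable bead up:
        -- the cell below a moved bead is a bead of μ again.
        up-propagates : Closed μ → ∀ {r₁ r₂} → CanMoveUp λ′ ν r₁ → CanMoveUp λ′ ν r₂ → δ r₁ ≡ up → δ r₂ ≡ up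
        up-propagates cl {r₁} {r₂} u₁@(rp₁ , _) u₂@(rp₂ , _) d₁ with ℤP.<-cmp (level (beta λ′ r₁)) (level (beta λ′ r₂))
        ... | tri≈ _ eq _ = subst (λ r → δ r ≡ up) (beta-injective Lλ (trans (cell-of-runner (beta λ′ r₁) rp₁) (trans (cong (λ t → cell t p) eq) (sym (cell-of-runner (beta λ′ r₂) rp₂))))) d₁
        ... | tri> _ _ gt = up-target-lower u₂ (proj₁ b₂) (trans (proj₂ b₂) (sym (trans (cong (ℤ._+ 1ℤ) (cell-of-runner (beta λ′ r₂) rp₂)) (cell-prev-+1 i _))))
          where
          b₁ : Bead μ (cell (level (beta λ′ r₁) ℤ.+ s) i)
          b₁ = r₁ , trans (beta-up d₁) (trans (cong (ℤ._+ 1ℤ) (cell-of-runner (beta λ′ r₁) rp₁)) (cell-prev-+1 i _))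
          b₂ : Bead μ (cell (level (beta λ′ r₂) ℤ.+ s) i)
          b₂ = closed-lower cl (ℤP.+-monoˡ-≤ s (ℤP.<⇒≤ gt)) b₁
        ... | tri< lt _ _ with δ r₂ in d₂
        ...   | up = refl
        ...   | down = ⊥-elim (prev≢ i (trans (sym rp₂) (down-on-current r₂ d₂)))
        ...   | stay = ⊥-elim (up-target-same u₁ d₁ (proj₁ b₁) (trans (proj₂ b₁) (sym (cell-of-runner (beta λ′ r₁) rp₁))))
          where
          b₂ : Bead μ (cell (level (beta λ′ r₂)) p)
          b₂ = r₂ , trans (beta-stay d₂) (cell-of-runner (beta λ′ r₂) rp₂)
          b₁ : Bead μ (cell (level (beta λ′ r₁)) p)
          b₁ = closed-lower cl (ℤP.<⇒≤ lt) b₂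

        down-propagates : Closed μ → ∀ {r₁ r₂} → CanMoveDown λ′ ν r₁ → CanMoveDown λ′ ν r₂ → δ r₁ ≡ down → δ r₂ ≡ down
        down-propagates cl {r₁} {r₂} u₁@(ri₁ , _) u₂@(ri₂ , _) d₁ with ℤP.<-cmp (level (beta λ′ r₁)) (level (beta λ′ r₂))
        ... | tri≈ _ eq _ = subst (λ r → δ r ≡ down) (beta-injective Lλ (trans (cell-of-runner (beta λ′ r₁) ri₁) (trans (cong (λ t → cell t i) eq) (sym (cell-of-runner (beta λ′ r₂) ri₂))))) d₁
        ... | tri> _ _ gt = down-target-higher u₂ (proj₁ b₂) (trans (proj₂ b₂) (sym (trans (cong (_- 1ℤ) (cell-of-runner (beta λ′ r₂) ri₂)) (cell-current-1 i _))))
          where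
          b₁ : Bead μ (cell (level (beta λ′ r₁) - s) p)
          b₁ = r₁ , trans (beta-down d₁) (trans (cong (_- 1ℤ) (cell-of-runner (beta λ′ r₁) ri₁)) (cell-current-1 i _))
          b₂ : Bead μ (cell (level (beta λ′ r₂) - s) p)
          b₂ = closed-lower cl (ℤP.+-monoˡ-≤ (- s) (ℤP.<⇒≤ gt)) b₁
        ... | tri< lt _ _ with δ r₂ in d₂
        ...   | down = refl
        ...   | up = ⊥-elim (prev≢ i (trans (sym (up-on-prev r₂ d₂)) ri₂))
        ...   | stay = ⊥-elim (down-target-same u₁ d₁ (proj₁ b₁) (trans (proj₂ b₁) (sym (cell-of-runner (beta λ′ r₁) ri₁))))
          where
          b₂ : Bead μ (cell (level (beta λ′ r₂)) i)
          b₂ = r₂ , trans (beta-stay d₂) (cell-of-runner (beta λ′ r₂) ri₂)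
          b₁ : Bead μ (cell (level (beta λ′ r₁)) i)
          b₁ = closed-lower cl (ℤP.<⇒≤ lt) b₂

    shift-canonical : ∀ {λ′ μ ν} → IsPartition λ′ → Heights λ′ ν → IsCore A μ → DiffOnly A i λ′ μ →
           ((Σ ℕ λ r → CanMoveUp λ′ ν r ⊎ CanMoveDown λ′ ν r) → μ ≢ λ′) →
           ∀ r → beta μ r ≡ beta λ′ r ℤ.+ shiftℤ (canonicalShift λ′ ν r)
    shift-canonical {λ′} {μ} {ν} Pλ H cμ@(Pμ , _) dif μ≢λ r = trans (proj₁ RS r) (cong (λ d → beta λ′ r ℤ.+ shiftℤ d) (δ≡canonical r))
      where
      δ = proj₁ (rowShift-of-diffOnly {λ′} {μ} dif)
      RS = proj₂ (rowShift-of-diffOnly {λ′} {μ} dif)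
      cl = core⇒closed cμ
      open RowShiftFacts (proj₁ Pλ) (proj₁ Pμ) RS
      open WithHeights {ν} H
      stay≢up : stay ≢ up
      stay≢up ()
      stay≢down : stay ≢ down
      stay≢down ()
      δ≡canonical : ∀ r → δ r ≡ canonicalShift λ′ ν r
      δ≡canonical r with canMoveUp? λ′ ν r | canMoveDown? λ′ ν r | δ r in dr
      ... | yes mu | _ | up = refl
      ... | yes mu | _ | down = ⊥-elim (¬up∧down {λ′} {ν} H mu (down⇒canMoveDown dr))
      ... | yes mu | _ | stay = ⊥-elim (μ≢λ (r , inj₁ mu) (all-stay⇒≡ Pλ Pμ λ r' → shift≡stay
              (λ u → stay≢up (trans (sym dr) (up-propagates cl (up⇒canMoveUp u) mu u)))
              (λ d → ¬up∧down {λ′} {ν} H mu (down⇒canMoveDown d))))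
      ... | no _ | yes md | down = refl
      ... | no _ | yes md | up = ⊥-elim (¬up∧down {λ′} {ν} H (up⇒canMoveUp dr) md)
      ... | no _ | yes md | stay = ⊥-elim (μ≢λ (r , inj₂ md) (all-stay⇒≡ Pλ Pμ λ r' → shift≡stay
              (λ u → ¬up∧down {λ′} {ν} H (up⇒canMoveUp u) md)
              (λ d → stay≢down (trans (sym dr) (down-propagates cl (down⇒canMoveDown d) md d)))))
      ... | no nu | no nd | stay = refl
      ... | no nu | no nd | up = ⊥-elim (nu (up⇒canMoveUp dr))
      ... | no nu | no nd | down = ⊥-elim (nd (down⇒canMoveDown dr))

    canonicalShift-up : ∀ {λ′ ν r} → CanMoveUp λ′ ν r → canonicalShift λ′ ν r ≡ up
    canonicalShift-up {λ′} {ν} {r} u with canMoveUp? λ′ ν r | canMoveDown? λ′ ν r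
    ... | yes _ | _ = refl
    ... | no nu | _ = ⊥-elim (nu u)

    canonicalShift-down : ∀ {λ′ ν r} → ¬ CanMoveUp λ′ ν r → CanMoveDown λ′ ν r → canonicalShift λ′ ν r ≡ down
    canonicalShift-down {λ′} {ν} {r} nu d with canMoveUp? λ′ ν r | canMoveDown? λ′ ν r
    ... | yes u | _ = ⊥-elim (nu u)
    ... | no _ | yes _ = refl
    ... | no _ | no nd = ⊥-elim (nd d)

    canonicalShift-stay : ∀ {λ′ ν r} → ¬ CanMoveUp λ′ ν r → ¬ CanMoveDown λ′ ν r → canonicalShift λ′ ν r ≡ stay
    canonicalShift-stay {λ′} {ν} {r} nu nd with canMoveUp? λ′ ν r | canMoveDown? λ′ ν r
    ... | yes u | _ = ⊥-elim (nu u)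
    ... | no _ | yes d = ⊥-elim (nd d)
    ... | no _ | no _ = refl

    data ShiftView (λ′ : List ℕ) (ν : Fin A → ℤ) (r : ℕ) : Set where
      moves-up : canonicalShift λ′ ν r ≡ up → CanMoveUp λ′ ν r → ShiftView λ′ ν r
      moves-down : canonicalShift λ′ ν r ≡ down → CanMoveDown λ′ ν r → ShiftView λ′ ν r
      stays : canonicalShift λ′ ν r ≡ stay → ¬ CanMoveUp λ′ ν r → ¬ CanMoveDown λ′ ν r → ShiftView λ′ ν r

    shiftView : ∀ λ′ ν r → ShiftView λ′ ν r
    shiftView λ′ ν r with canMoveUp? λ′ ν r | canMoveDown? λ′ ν r
    ... | yes u | _ = moves-up (canonicalShift-up u) u
    ... | no nu | yes d = moves-down (canonicalShift-down nu d) d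
    ... | no nu | no nd = stays (canonicalShift-stay nu nd) nu nd

    canonical-up⇒canMoveUp : ∀ {λ′ ν r} → canonicalShift λ′ ν r ≡ up → CanMoveUp λ′ ν r
    canonical-up⇒canMoveUp {λ′} {ν} {r} e with shiftView λ′ ν r
    ... | moves-up _ u = u
    ... | moves-down e' _ with () ← trans (sym e) e'
    ... | stays e' _ _ with () ← trans (sym e) e'

    canonical-down⇒canMoveDown : ∀ {λ′ ν r} → canonicalShift λ′ ν r ≡ down → CanMoveDown λ′ ν r
    canonical-down⇒canMoveDown {λ′} {ν} {r} e with shiftView λ′ ν r
    ... | moves-down _ d = d
    ... | moves-up e' _ with () ← trans (sym e) e'
    ... | stays e' _ _ with () ← trans (sym e) e'

    canonical-stay⇒immobile : ∀ {λ′ ν r} → canonicalShift λ′ ν r ≡ stay → ¬ CanMoveUp λ′ ν r × ¬ CanMoveDown λ′ ν r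
    canonical-stay⇒immobile {λ′} {ν} {r} e with shiftView λ′ ν r
    ... | stays _ nu nd = nu , nd
    ... | moves-up e' _ with () ← trans (sym e) e'
    ... | moves-down e' _ with () ← trans (sym e) e'

    reflectHeights : (Fin A → ℤ) → Fin A → ℤ
    reflectHeights ν ρ with ρ Fin.≟ p | ρ Fin.≟ i
    ... | yes _ | _ = ν i - s
    ... | no _ | yes _ = ν p ℤ.+ s
    ... | no _ | no _ = ν ρ

    reflectHeights-prev : ∀ ν → reflectHeights ν p ≡ ν i - s
    reflectHeights-prev ν with p Fin.≟ p | p Fin.≟ i
    ... | yes _ | _ = refl
    ... | no ne | _ = ⊥-elim (ne refl)

    reflectHeights-current : ∀ ν → reflectHeights ν i ≡ ν p ℤ.+ s
    reflectHeights-current ν with i Fin.≟ p | i Fin.≟ i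
    ... | yes e | _ = ⊥-elim (prev≢ i (sym e))
    ... | no _ | yes _ = refl
    ... | no _ | no ne = ⊥-elim (ne refl)

    reflectHeights-other : ∀ ν ρ → ρ ≢ p → ρ ≢ i → reflectHeights ν ρ ≡ ν ρ
    reflectHeights-other ν ρ n₁ n₂ with ρ Fin.≟ p | ρ Fin.≟ i
    ... | yes e | _ = ⊥-elim (n₁ e)
    ... | no _ | yes e = ⊥-elim (n₂ e)
    ... | no _ | no _ = refl

    module CanonicalShift {λ′ μ ν} (H : Heights λ′ ν) (beta-μ : ∀ r → beta μ r ≡ beta λ′ r ℤ.+ shiftℤ (canonicalShift λ′ ν r)) where
      private
        ν' = reflectHeights ν

        beta-μ-as : ∀ r {d} → canonicalShift λ′ ν r ≡ d → beta μ r ≡ beta λ′ r ℤ.+ shiftℤ d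
        beta-μ-as r e = trans (beta-μ r) (cong (λ d → beta λ′ r ℤ.+ shiftℤ d) e)

        stay-bead : ∀ {r z} → canonicalShift λ′ ν r ≡ stay → beta λ′ r ≡ z → Bead μ z
        stay-bead {r} e b = r , trans (beta-μ-as r e) (trans (ℤP.+-identityʳ _) b)

        occupied-λ : ∀ r → Occupied ν (beta λ′ r)
        occupied-λ r = proj₁ (H _) (r , refl)

      immobile-occupied : ∀ r → ¬ CanMoveUp λ′ ν r → ¬ CanMoveDown λ′ ν r → Occupied ν' (beta λ′ r)
      immobile-occupied r nu nd = by-runner (runner w Fin.≟ p) (runner w Fin.≟ i)
        where
        w = beta λ′ r
        by-runner : Dec (runner w ≡ p) → Dec (runner w ≡ i) → Occupied ν' w
        by-runner (yes rp) _ = occupied-on⇐ {ν'} rp (subst (level w ℤ.<_) (sym (reflectHeights-prev ν))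
                                 (i+k<j⇒i<j-k (occupied-next {ν} rp (decidable-stable (occupied? ν _) (λ nx → nu (rp , nx))))))
        by-runner (no _) (yes ri) = occupied-on⇐ {ν'} ri (subst (level w ℤ.<_) (sym (reflectHeights-current ν))
                                     (i-k<j⇒i<j+k (occupied-pred {ν} ri (decidable-stable (occupied? ν _) (λ nx → nd (ri , nx))))))
        by-runner (no n₁) (no n₂) = subst (level w ℤ.<_) (sym (reflectHeights-other ν _ n₁ n₂)) (occupied-λ r)

      bead⇒occupied : ∀ z → Bead μ z → Occupied ν' z
      bead⇒occupied z (r , refl) with shiftView λ′ ν r
      ... | moves-up e (rp , _) = subst (Occupied ν') (sym (beta-μ-as r e))
              (occupied-next⇐ {ν'} rp (subst (level (beta λ′ r) ℤ.+ s ℤ.<_) (sym (reflectHeights-current ν))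
                 (ℤP.+-monoˡ-< s (occupied-on {ν} rp (occupied-λ r)))))
      ... | moves-down e (ri , _) = subst (Occupied ν') (sym (beta-μ-as r e))
              (occupied-pred⇐ {ν'} ri (subst (level (beta λ′ r) - s ℤ.<_) (sym (reflectHeights-prev ν))
                 (ℤP.+-monoˡ-< (- s) (occupied-on {ν} ri (occupied-λ r)))))
      ... | stays e nu nd = subst (Occupied ν') (sym (trans (beta-μ-as r e) (ℤP.+-identityʳ _))) (immobile-occupied r nu nd)

      occupied-prev⇒bead : ∀ {z} → runner z ≡ p → Occupied ν' z → Bead μ z
      occupied-prev⇒bead {z} rp h with occupied? ν z
      ... | yes occ = stay-bead (canonicalShift-stay (λ u → proj₂ u (subst (λ w → Occupied ν (w ℤ.+ 1ℤ)) (sym (proj₂ b)) next-occ))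
                                                     (λ d → prev≢ i (trans (sym rp) (trans (cong runner (sym (proj₂ b))) (proj₁ d)))))
                                (proj₂ b)
        where
        b = proj₂ (H z) occ
        next-occ = occupied-next⇐ {ν} rp (i<j-k⇒i+k<j (subst (level z ℤ.<_) (reflectHeights-prev ν) (occupied-on {ν'} rp h)))
      ... | no free = r₁ , trans (beta-μ-as r₁ down-r₁) (trans (cong (_- 1ℤ) (proj₂ b₁)) (i+1-1≡i z))
        where
        b₁ = proj₂ (H (z ℤ.+ 1ℤ)) (occupied-next⇐ {ν} rp (i<j-k⇒i+k<j (subst (level z ℤ.<_) (reflectHeights-prev ν) (occupied-on {ν'} rp h))))
        r₁ = proj₁ b₁
        ri₁ : runner (beta λ′ r₁) ≡ i
        ri₁ = trans (cong runner (proj₂ b₁)) (proj₁ (next-of-prev i z rp))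
        down-r₁ : canonicalShift λ′ ν r₁ ≡ down
        down-r₁ = canonicalShift-down (λ u → prev≢ i (trans (sym (proj₁ u)) ri₁))
                    (ri₁ , λ occ → free (subst (Occupied ν) (trans (cong (_- 1ℤ) (proj₂ b₁)) (i+1-1≡i z)) occ))

      occupied-current⇒bead : ∀ {z} → runner z ≡ i → Occupied ν' z → Bead μ z
      occupied-current⇒bead {z} ri h with occupied? ν z
      ... | yes occ = stay-bead (canonicalShift-stay (λ u → prev≢ i (trans (sym (proj₁ u)) (trans (cong runner (proj₂ b)) ri)))
                                                     (λ d → proj₂ d (subst (λ w → Occupied ν (w - 1ℤ)) (sym (proj₂ b)) pred-occ)))
                                (proj₂ b)
        where
        b = proj₂ (H z) occ
        pred-occ = occupied-pred⇐ {ν} ri (i<j+k⇒i-k<j (subst (level z ℤ.<_) (reflectHeights-current ν) (occupied-on {ν'} ri h)))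
      ... | no free = r₁ , trans (beta-μ-as r₁ up-r₁) (trans (cong (ℤ._+ 1ℤ) (proj₂ b₁)) (i-1+1≡i z))
        where
        b₁ = proj₂ (H (z - 1ℤ)) (occupied-pred⇐ {ν} ri (i<j+k⇒i-k<j (subst (level z ℤ.<_) (reflectHeights-current ν) (occupied-on {ν'} ri h))))
        r₁ = proj₁ b₁
        up-r₁ : canonicalShift λ′ ν r₁ ≡ up
        up-r₁ = canonicalShift-up (trans (cong runner (proj₂ b₁)) (proj₁ (prev-of-current i z ri)) ,
                                   λ occ → free (subst (Occupied ν) (trans (cong (ℤ._+ 1ℤ) (proj₂ b₁)) (i-1+1≡i z)) occ))

      occupied⇒bead : ∀ z → Occupied ν' z → Bead μ z
      occupied⇒bead z h = by-runner (runner z Fin.≟ p) (runner z Fin.≟ i)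
        where
        by-runner : Dec (runner z ≡ p) → Dec (runner z ≡ i) → Bead μ z
        by-runner (yes rp) _ = occupied-prev⇒bead rp h
        by-runner (no _) (yes ri) = occupied-current⇒bead ri h
        by-runner (no n₁) (no n₂) = stay-bead (canonicalShift-stay (λ u → n₁ (trans (cong runner (sym (proj₂ b))) (proj₁ u)))
                                                                   (λ d → n₂ (trans (cong runner (sym (proj₂ b))) (proj₁ d))))
                                              (proj₂ b)
          where
          b = proj₂ (H z) (subst (level z ℤ.<_) (reflectHeights-other ν (runner z) n₁ n₂) h)

      heights : Heights μ ν'
      heights z = bead⇒occupied z , occupied⇒bead z

-- Existence of s_i λ: move every movable bead

module Existence (n : ℕ) where
  open Runners n
  open Action n

  applyShift : Shift → ℕ → ℕ
  applyShift up R = suc R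
  applyShift stay R = R
  applyShift down R = R ∸ 1

  beta-applyShift : ∀ λ′ μ r d → (d ≡ down → 0 ℕ.< rowLen λ′ r) → rowLen μ r ≡ applyShift d (rowLen λ′ r) →
                    beta μ r ≡ beta λ′ r ℤ.+ shiftℤ d
  beta-applyShift λ′ μ r up _ eq = rowLen-suc⇒beta-+1 {λ′} {μ} r eq
  beta-applyShift λ′ μ r stay _ eq = trans (rowLen-≡⇒beta-≡ {λ′} {μ} r eq) (sym (ℤP.+-identityʳ _))
  beta-applyShift λ′ μ r down nonempty eq = trans (beta-def μ r) (trans (cong (λ w → + w - + suc r) eq)
    (trans (cong (_- + suc r) (+-∸ (nonempty refl))) (trans (e (+ rowLen λ′ r) (+ suc r)) (cong (_- 1ℤ) (sym (beta-def λ′ r))))))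
    where
    e : ∀ R r → R - 1ℤ - r ≡ R - r - 1ℤ
    e = solve-∀

  module Reflection (i : Fin A) {λ′ : List ℕ} {ν : Fin A → ℤ} (Pλ : IsPartition λ′) (H : Heights λ′ ν) where
    private
      Lλ = proj₁ Pλ
      δ = canonicalShift i λ′ ν
      ν' = reflectHeights i ν

      bead : ∀ {r z} → beta λ′ r ≡ z → Occupied ν z
      bead {r} e = proj₁ (H _) (r , e)

      <⇒≤-pred : ∀ {a b} → a ℕ.< b → a ℕ.≤ b ∸ 1
      <⇒≤-pred {b = suc b} (s≤s le) = le

    down⇒row-nonempty : ∀ r → δ r ≡ down → 0 ℕ.< rowLen λ′ r
    down⇒row-nonempty r e with rowLen λ′ r in er
    ... | suc _ = s≤s z≤n
    ... | zero = ⊥-elim (proj₂ (canonical-down⇒canMoveDown i e) (bead (+1≡⇒≡-1 (sym (equal-rows⇒beta-+1 λ′ r (trans r₁ (sym er)))))))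
      where
      r₁ : rowLen λ′ (suc r) ≡ 0
      r₁ = ℕP.n≤0⇒n≡0 (subst (rowLen λ′ (suc r) ℕ.≤_) er (rowLen-suc-≤ Lλ r))

    rows : ℕ → ℕ
    rows r = applyShift (δ r) (rowLen λ′ r)

    up⇒row-shorter : ∀ r → CanMoveUp i λ′ ν (suc r) → rowLen λ′ (suc r) ≢ rowLen λ′ r
    up⇒row-shorter r u eq = proj₂ u (bead (equal-rows⇒beta-+1 λ′ r eq))

    down⇒row-longer : ∀ r → CanMoveDown i λ′ ν r → rowLen λ′ (suc r) ≢ rowLen λ′ r
    down⇒row-longer r d eq = proj₂ d (bead (+1≡⇒≡-1 (sym (equal-rows⇒beta-+1 λ′ r eq))))

    rows-antitone : Antitone rows
    rows-antitone r with δ r in e₀ | δ (suc r) in e₁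
    ... | up | down = ℕP.≤-trans (ℕP.m∸n≤m _ 1) (ℕP.m≤n⇒m≤1+n (rowLen-suc-≤ Lλ r))
    ... | up | stay = ℕP.m≤n⇒m≤1+n (rowLen-suc-≤ Lλ r)
    ... | up | up = s≤s (rowLen-suc-≤ Lλ r)
    ... | stay | down = ℕP.≤-trans (ℕP.m∸n≤m _ 1) (rowLen-suc-≤ Lλ r)
    ... | stay | stay = rowLen-suc-≤ Lλ r
    ... | stay | up = ℕP.≤∧≢⇒< (rowLen-suc-≤ Lλ r) (up⇒row-shorter r (canonical-up⇒canMoveUp i e₁))
    ... | down | down = ℕP.∸-monoˡ-≤ 1 (rowLen-suc-≤ Lλ r)
    ... | down | stay = <⇒≤-pred (ℕP.≤∧≢⇒< (rowLen-suc-≤ Lλ r) (down⇒row-longer r (canonical-down⇒canMoveDown i e₀)))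
    ... | down | up = <⇒≤-pred (ℕP.≤∧≢⇒< (ℕP.≤∧≢⇒< (rowLen-suc-≤ Lλ r) (up⇒row-shorter r (canonical-up⇒canMoveUp i e₁))) no-step)
      where
      no-step : suc (rowLen λ′ (suc r)) ≢ rowLen λ′ r
      no-step eq = prev≢ i (trans (sym (proj₁ (prev-of-current i _ (proj₁ (canonical-down⇒canMoveDown i e₀)))))
                    (trans (cong runner meet) (proj₁ (next-of-prev i _ (proj₁ (canonical-up⇒canMoveUp i e₁))))))
        where
        meet : beta λ′ r - 1ℤ ≡ beta λ′ (suc r) ℤ.+ 1ℤ
        meet = trans (cong (_- 1ℤ) (step-rows⇒beta-+2 λ′ r eq)) (i+1-1≡i _)

    rows-beyond : ∀ r → suc (length λ′) ℕ.≤ r → rows r ≡ 0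
    rows-beyond (suc r) (s≤s le) = trans (cong (λ d → applyShift d (rowLen λ′ (suc r))) next-stays) z₁
      where
      z₀ = rowLen-beyond λ′ r le
      z₁ = rowLen-beyond λ′ (suc r) (ℕP.m≤n⇒m≤1+n le)
      z₂ = rowLen-beyond λ′ (suc (suc r)) (ℕP.m≤n⇒m≤1+n (ℕP.m≤n⇒m≤1+n le))
      next-stays : δ (suc r) ≡ stay
      next-stays = canonicalShift-stay i (λ u → proj₂ u (bead {r} (equal-rows⇒beta-+1 λ′ r (trans z₁ (sym z₀)))))
                (λ d → proj₂ d (bead {suc (suc r)} (+1≡⇒≡-1 (sym (equal-rows⇒beta-+1 λ′ (suc r) (trans z₂ (sym z₁)))))))

    reflected : List ℕ
    reflected = fromRows rows (suc (length λ′))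

    rowLen-reflected : ∀ r → rowLen reflected r ≡ rows r
    rowLen-reflected = rowLen-fromRows rows _ rows-antitone rows-beyond

    reflected-isPartition : IsPartition reflected
    reflected-isPartition = fromRows-isPartition rows _ rows-antitone rows-beyond

    beta-reflected : ∀ r → beta reflected r ≡ beta λ′ r ℤ.+ shiftℤ (δ r)
    beta-reflected r = beta-applyShift λ′ reflected r (δ r) (down⇒row-nonempty r) (rowLen-reflected r)

    reflected-heights : Heights reflected ν'
    reflected-heights = CanonicalShift.heights i H beta-reflected

    reflected-closed : Closed reflected
    reflected-closed z b = proj₂ (reflected-heights (z - aℤ)) (subst (Occupied ν') below (occupied-cell⇐ ν' (level z - 1ℤ) (runner z) lt))
      where
      below : cell (level z - 1ℤ) (runner z) ≡ z - aℤ
      below = trans (sym (cell-pred-level (level z) (runner z))) (cong (_- aℤ) (cell-level-runner z))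
      lt : level z - 1ℤ ℤ.< ν' (runner z)
      lt = ℤP.<-trans (<-offset 0 (sym (i-1+1≡i (level z)))) (proj₁ (reflected-heights z) b)

    content-up : ∀ r → CanMoveUp i λ′ ν r → Content A r (rowLen λ′ r) i
    content-up r u = runner⇒content {r} {rowLen λ′ r} {i} (trans (cong runner (rowLen-row≡beta+1 λ′ r)) (proj₁ (next-of-prev i _ (proj₁ u))))

    content-down : ∀ r → CanMoveDown i λ′ ν r → Content A r (rowLen λ′ r ∸ 1) i
    content-down r d = runner⇒content {r} {rowLen λ′ r ∸ 1} {i} (trans (cong runner last-box) (proj₁ d))
      where
      e : ∀ R r → R - 1ℤ - r ≡ R - (1ℤ ℤ.+ r)
      e = solve-∀
      nonempty = down⇒row-nonempty r (canonicalShift-down i (λ u → ¬up∧down i {λ′} {ν} H u d) d)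
      last-box : + (rowLen λ′ r ∸ 1) - + r ≡ beta λ′ r
      last-box = trans (cong (_- + r) (+-∸ nonempty)) (trans (e (+ rowLen λ′ r) (+ r)) (sym (beta-def λ′ r)))

    reflected-diffOnly : DiffOnly A i λ′ reflected
    reflected-diffOnly r c nct = subst (λ w → (c ℕ.< rowLen λ′ r) ⇔ (c ℕ.< w)) (sym (rowLen-reflected r)) unchanged
      where
      unchanged : (c ℕ.< rowLen λ′ r) ⇔ (c ℕ.< rows r)
      unchanged with δ r in e
      ... | stay = mk⇔ (λ h → h) (λ h → h)
      ... | up = mk⇔ ℕP.m<n⇒m<1+n (λ h → ℕP.≤∧≢⇒< (ℕP.≤-pred h)
                   (λ ceq → nct (subst (λ w → Content A r w i) (sym ceq) (content-up r (canonical-up⇒canMoveUp i e)))))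
      ... | down = mk⇔ (λ h → ℕP.≤∧≢⇒< (<⇒≤-pred h) (λ ceq → nct (subst (λ w → Content A r w i) (sym ceq) (content-down r (canonical-down⇒canMoveDown i e)))))
                     (λ h → ℕP.<-≤-trans h (ℕP.m∸n≤m _ 1))

    moved-row-changes : ∀ r → δ r ≢ stay → rowLen reflected r ≢ rowLen λ′ r
    moved-row-changes r moved eq with δ r in e | rowLen-reflected r
    ... | stay | _ = moved refl
    ... | up | row = ℕP.<-irrefl (sym (trans (sym row) eq)) (ℕP.n<1+n (rowLen λ′ r))
    ... | down | row = ℕP.<-irrefl (trans (sym row) eq) (ℕP.∸-monoʳ-< {o = 0} (s≤s z≤n) (down⇒row-nonempty r e))

    reflected-≡⇒all-stay : reflected ≡ λ′ → ∀ r → δ r ≡ stay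
    reflected-≡⇒all-stay eq r = shift≡stay (λ u → moved-row-changes r (λ s → up≢stay (trans (sym u) s)) (cong (λ l → rowLen l r) eq))
                                           (λ d → moved-row-changes r (λ s → down≢stay (trans (sym d) s)) (cong (λ l → rowLen l r) eq))
      where
      up≢stay : up ≢ stay
      up≢stay ()
      down≢stay : down ≢ stay
      down≢stay ()

    movable⇒reflected-≢ : (Σ ℕ λ r → CanMoveUp i λ′ ν r ⊎ CanMoveDown i λ′ ν r) → reflected ≢ λ′
    movable⇒reflected-≢ (r , inj₁ u) eq = proj₁ (canonical-stay⇒immobile i (reflected-≡⇒all-stay eq r)) u
    movable⇒reflected-≢ (r , inj₂ d) eq = proj₂ (canonical-stay⇒immobile i (reflected-≡⇒all-stay eq r)) d

    -- If reflected = λ, no bead of λ is movable, so every core differing from λ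
    -- only in boxes of content i equals λ.
    reflected-sstep : SStep A i λ′ reflected
    reflected-sstep = closed⇒core reflected-isPartition reflected-closed , reflected-diffOnly , other-≢⇒reflected-≢
      where
      other-≢⇒reflected-≢ : (Σ (List ℕ) λ κ → IsCore A κ × DiffOnly A i λ′ κ × κ ≢ λ′) → reflected ≢ λ′
      other-≢⇒reflected-≢ (κ , (Pκ , _) , dif , κ≢λ) eq = κ≢λ (all-stay⇒≡ Pλ Pκ (λ r → shift≡stay
          (λ u → proj₁ (canonical-stay⇒immobile i (reflected-≡⇒all-stay eq r)) (up⇒canMoveUp u))
          (λ d → proj₂ (canonical-stay⇒immobile i (reflected-≡⇒all-stay eq r)) (down⇒canMoveDown d))))
        where
        open RowShiftFacts i (proj₁ Pλ) (proj₁ Pκ) (proj₂ (rowShift-of-diffOnly i {λ′} {κ} dif))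
        open WithHeights {ν} H

Σℕ : (ℕ → ℕ) → ℕ → ℕ
Σℕ g zero = 0
Σℕ g (suc N) = g 0 ℕ.+ Σℕ (λ r → g (suc r)) N

Σℤ : (ℕ → ℤ) → ℕ → ℤ
Σℤ g zero = 0ℤ
Σℤ g (suc N) = g 0 ℤ.+ Σℤ (λ r → g (suc r)) N

Σℕ-zero : ∀ g N → (∀ r → g r ≡ 0) → Σℕ g N ≡ 0
Σℕ-zero g zero h = refl
Σℕ-zero g (suc N) h rewrite h 0 = Σℕ-zero (λ r → g (suc r)) N (λ r → h (suc r))

Σℕ-ℤ : ∀ g N → + Σℕ g N ≡ Σℤ (λ r → + g r) N
Σℕ-ℤ g zero = refl
Σℕ-ℤ g (suc N) = trans (ℤP.pos-+ (g 0) _) (cong (λ w → + g 0 ℤ.+ w) (Σℕ-ℤ (λ r → g (suc r)) N))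

Σℤ-cong : ∀ g h N → (∀ r → g r ≡ h r) → Σℤ g N ≡ Σℤ h N
Σℤ-cong g h zero e = refl
Σℤ-cong g h (suc N) e = cong₂ ℤ._+_ (e 0) (Σℤ-cong _ _ N (λ r → e (suc r)))

Σℤ-+ : ∀ g h N → Σℤ (λ r → g r ℤ.+ h r) N ≡ Σℤ g N ℤ.+ Σℤ h N
Σℤ-+ g h zero = refl
Σℤ-+ g h (suc N) = trans (cong (λ w → g 0 ℤ.+ h 0 ℤ.+ w) (Σℤ-+ _ _ N)) (e (g 0) (h 0) (Σℤ (λ r → g (suc r)) N) (Σℤ (λ r → h (suc r)) N))
  where
  e : ∀ a b c d → a ℤ.+ b ℤ.+ (c ℤ.+ d) ≡ a ℤ.+ c ℤ.+ (b ℤ.+ d)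
  e = solve-∀

Σℤ-- : ∀ g h N → Σℤ (λ r → g r - h r) N ≡ Σℤ g N - Σℤ h N
Σℤ-- g h zero = refl
Σℤ-- g h (suc N) = trans (cong (λ w → g 0 - h 0 ℤ.+ w) (Σℤ-- _ _ N)) (e (g 0) (h 0) (Σℤ (λ r → g (suc r)) N) (Σℤ (λ r → h (suc r)) N))
  where
  e : ∀ a b c d → a - b ℤ.+ (c - d) ≡ a ℤ.+ c - (b ℤ.+ d)
  e = solve-∀

size≡Σℕ : ∀ λ′ N → length λ′ ℕ.≤ N → size λ′ ≡ Σℕ (rowLen λ′) N
size≡Σℕ [] N _ = sym (Σℕ-zero _ N (λ r → refl))
size≡Σℕ (h ∷ t) (suc N) (s≤s le) = cong (h ℕ.+_) (size≡Σℕ t N le)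

indicator : ∀ {P : Set} → Dec P → ℤ
indicator (yes _) = 1ℤ
indicator (no _) = 0ℤ

indicator-cong : ∀ {P Q : Set} (P? : Dec P) (Q? : Dec Q) → (P → Q) → (Q → P) → indicator P? ≡ indicator Q?
indicator-cong (yes _) (yes _) f g = refl
indicator-cong (yes p) (no ¬q) f g = ⊥-elim (¬q (f p))
indicator-cong (no ¬p) (yes q) f g = ⊥-elim (¬p (g q))
indicator-cong (no _) (no _) f g = refl

Σ-indicator-none : ∀ {P : ℕ → Set} (P? : ∀ r → Dec (P r)) N → (∀ r → ¬ P r) → Σℤ (λ r → indicator (P? r)) N ≡ 0ℤ
Σ-indicator-none P? zero h = refl
Σ-indicator-none P? (suc N) h with P? 0
... | yes p = ⊥-elim (h 0 p)
... | no _ = trans (ℤP.+-identityˡ _) (Σ-indicator-none (λ r → P? (suc r)) N (λ r → h (suc r)))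

Σ-indicator-single : ∀ {P : ℕ → Set} (P? : ∀ r → Dec (P r)) r₀ N → r₀ ℕ.< N → (∀ r → P r → r ≡ r₀) → P r₀ →
                     Σℤ (λ r → indicator (P? r)) N ≡ 1ℤ
Σ-indicator-single P? zero (suc N) _ u p₀ with P? 0
... | yes _ = cong (λ w → 1ℤ ℤ.+ w) (Σ-indicator-none (λ r → P? (suc r)) N (λ r pr → ℕP.0≢1+n (sym (u (suc r) pr))))
... | no ¬p = ⊥-elim (¬p p₀)
Σ-indicator-single P? (suc r₀) (suc N) (s≤s lt) u p₀ with P? 0
... | yes p = ⊥-elim (ℕP.0≢1+n (u 0 p))
... | no _ = trans (ℤP.+-identityˡ _) (Σ-indicator-single (λ r → P? (suc r)) r₀ N lt (λ r pr → ℕP.suc-injective (u (suc r) pr)) p₀)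

-- The size of s_i λ

module Size (n : ℕ) where
  open Runners n
  open Action n

  OnRunnerFrom : List ℕ → Fin A → ℤ → ℕ → Set
  OnRunnerFrom λ′ ρ lo r = runner (beta λ′ r) ≡ ρ × lo ℤ.≤ level (beta λ′ r)

  onRunnerFrom? : ∀ λ′ ρ lo r → Dec (OnRunnerFrom λ′ ρ lo r)
  onRunnerFrom? λ′ ρ lo r = (runner (beta λ′ r) Fin.≟ ρ) ×-dec (lo ℤ.≤? level (beta λ′ r))

  indicator-split : ∀ λ′ ρ lo r → indicator (onRunnerFrom? λ′ ρ lo r) ≡ indicator (onRunnerFrom? λ′ ρ (lo ℤ.+ 1ℤ) r) ℤ.+ indicator (beta λ′ r ℤ.≟ cell lo ρ)
  indicator-split λ′ ρ lo r with onRunnerFrom? λ′ ρ lo r | onRunnerFrom? λ′ ρ (lo ℤ.+ 1ℤ) r | beta λ′ r ℤ.≟ cell lo ρ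
  ... | yes _ | yes (_ , le') | yes e = ⊥-elim (ℤP.<-irrefl refl (ℤP.<-≤-trans (<-offset 0 refl) (subst (lo ℤ.+ 1ℤ ℤ.≤_) (trans (cong level e) (level-cell lo ρ)) le')))
  ... | yes _ | yes _ | no _ = refl
  ... | yes _ | no _ | yes _ = refl
  ... | yes (rq , le) | no ¬q | no ne = ⊥-elim (ne (trans (cell-of-runner _ rq) (cong (λ t → cell t ρ) (sym lo≡))))
    where
    lo≡ : lo ≡ level (beta λ′ r)
    lo≡ = ℤP.≤∧≮⇒≡ le (λ lt → ¬q (rq , subst (ℤ._≤ level (beta λ′ r)) (ℤP.+-comm 1ℤ lo) (ℤP.i<j⇒suc[i]≤j lt)))
  ... | no ¬q | yes (rq , le') | _ = ⊥-elim (¬q (rq , ℤP.≤-trans (ℤP.<⇒≤ (<-offset 0 refl)) le'))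
  ... | no ¬q | no _ | yes e = ⊥-elim (¬q (trans (cong runner e) (runner-cell lo ρ) , subst (lo ℤ.≤_) (sym (trans (cong level e) (level-cell lo ρ))) ℤP.≤-refl))
  ... | no _ | no _ | no _ = refl

  -- Runner ρ carries one bead on each level from lo up to its height ν ρ.
  count-onRunnerFrom : ∀ {λ′ ν} → Linked ℕ._≥_ λ′ → Heights λ′ ν → ∀ ρ d lo N → ν ρ ≡ lo ℤ.+ + d → beta λ′ N ℤ.< cell lo ρ →
                       Σℤ (λ r → indicator (onRunnerFrom? λ′ ρ lo r)) N ≡ + d
  count-onRunnerFrom {λ′} {ν} L H ρ zero lo N e far = Σ-indicator-none (onRunnerFrom? λ′ ρ lo) N (λ r q → ℤP.<-irrefl refl (ℤP.≤-<-trans (proj₂ q)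
        (subst (level (beta λ′ r) ℤ.<_) (trans (cong ν (proj₁ q)) (trans e (ℤP.+-identityʳ lo))) (proj₁ (H _) (r , refl)))))
  count-onRunnerFrom {λ′} {ν} L H ρ (suc d) lo N e far = begin
    Σℤ (λ r → indicator (onRunnerFrom? λ′ ρ lo r)) N                                           ≡⟨ Σℤ-cong _ _ N (indicator-split λ′ ρ lo) ⟩
    Σℤ (λ r → indicator (onRunnerFrom? λ′ ρ (lo ℤ.+ 1ℤ) r) ℤ.+ indicator (beta λ′ r ℤ.≟ cell lo ρ)) N ≡⟨ Σℤ-+ _ _ N ⟩
    Σℤ (λ r → indicator (onRunnerFrom? λ′ ρ (lo ℤ.+ 1ℤ) r)) N ℤ.+ Σℤ (λ r → indicator (beta λ′ r ℤ.≟ cell lo ρ)) N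
      ≡⟨ cong₂ ℤ._+_ (count-onRunnerFrom L H ρ d (lo ℤ.+ 1ℤ) N e' (ℤP.<-trans far (cell-< ρ ρ (<-offset 0 refl)))) one-at-lo ⟩
    + d ℤ.+ 1ℤ                                                                                  ≡⟨ ℤP.+-comm (+ d) 1ℤ ⟩
    + suc d                                                                                     ∎
    where
    open ≡-Reasoning
    e' : ν ρ ≡ lo ℤ.+ 1ℤ ℤ.+ + d
    e' = trans e (ar lo (+ d))
      where
      ar : ∀ lo d → lo ℤ.+ (1ℤ ℤ.+ d) ≡ lo ℤ.+ 1ℤ ℤ.+ d
      ar = solve-∀
    b₀ : Bead λ′ (cell lo ρ)
    b₀ = proj₂ (H _) (occupied-cell⇐ ν lo ρ (subst (lo ℤ.<_) (sym e) (<-offset d refl)))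
    one-at-lo : Σℤ (λ r → indicator (beta λ′ r ℤ.≟ cell lo ρ)) N ≡ 1ℤ
    one-at-lo = Σ-indicator-single (λ r → beta λ′ r ℤ.≟ cell lo ρ) (proj₁ b₀) N
          (ℕP.≰⇒> (λ N≤r₀ → ℤP.<-irrefl (proj₂ b₀) (ℤP.≤-<-trans (beta-antitone L N≤r₀) far)))
          (λ r er → beta-injective L (trans er (sym (proj₂ b₀)))) (proj₂ b₀)

  module _ (i : Fin A) where
    private
      p = prev i
      s = wrap i

    sizeShift : (Fin A → ℤ) → ℤ
    sizeShift ν = s ℤ.+ ν p - ν i

    module _ {λ′ ν} (H : Heights λ′ ν) where
      private
        UpFrom = OnRunnerFrom λ′ p (ν i - s)
        DownFrom = OnRunnerFrom λ′ i (ν p ℤ.+ s)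
        up? = onRunnerFrom? λ′ p (ν i - s)
        down? = onRunnerFrom? λ′ i (ν p ℤ.+ s)

        bead-level : ∀ {r ρ} → runner (beta λ′ r) ≡ ρ → level (beta λ′ r) ℤ.< ν ρ
        bead-level {r} eq = occupied-on {ν} eq (proj₁ (H _) (r , refl))

      canMoveUp⇔ : ∀ {r} → (CanMoveUp i λ′ ν r → UpFrom r) × (UpFrom r → CanMoveUp i λ′ ν r)
      canMoveUp⇔ = (λ { (rp , free) → rp , i≤j+k⇒i-k≤j (ℤP.≮⇒≥ (λ lt → free (occupied-next⇐ i {ν} rp lt))) })
                 , (λ { (rp , le) → rp , λ h → ℤP.≤⇒≯ le (i+k<j⇒i<j-k (occupied-next i {ν} rp h)) })

      canMoveDown⇔ : ∀ {r} → (CanMoveDown i λ′ ν r → DownFrom r) × (DownFrom r → CanMoveDown i λ′ ν r)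
      canMoveDown⇔ = (λ { (ri , free) → ri , i≤j-k⇒i+k≤j (ℤP.≮⇒≥ (λ lt → free (occupied-pred⇐ i {ν} ri lt))) })
                   , (λ { (ri , le) → ri , λ h → ℤP.≤⇒≯ le (i-k<j⇒i<j+k (occupied-pred i {ν} ri h)) })

      shift-indicators : ∀ r → shiftℤ (canonicalShift i λ′ ν r) ≡ indicator (up? r) - indicator (down? r)
      shift-indicators r = trans movable (cong₂ _-_ (indicator-cong (canMoveUp? i λ′ ν r) (up? r) (proj₁ canMoveUp⇔) (proj₂ canMoveUp⇔))
                                                    (indicator-cong (canMoveDown? i λ′ ν r) (down? r) (proj₁ canMoveDown⇔) (proj₂ canMoveDown⇔)))
        where
        movable : shiftℤ (canonicalShift i λ′ ν r) ≡ indicator (canMoveUp? i λ′ ν r) - indicator (canMoveDown? i λ′ ν r)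
        movable with canMoveUp? i λ′ ν r | canMoveDown? i λ′ ν r
        ... | yes u | yes d = ⊥-elim (¬up∧down i {λ′} {ν} H u d)
        ... | yes _ | no _ = refl
        ... | no _ | yes _ = refl
        ... | no _ | no _ = refl

      -- Only one of the two runners has movable beads: ν i - s of them on runner p
      -- if ν i - s ≤ ν p, else ν i - (ν p + s) on runner i.
      Σ-canonicalShift : Linked ℕ._≥_ λ′ → ∀ N → beta λ′ N ℤ.< cell (ν i - s) p → beta λ′ N ℤ.< cell (ν p ℤ.+ s) i →
                         Σℤ (λ r → shiftℤ (canonicalShift i λ′ ν r)) N ≡ sizeShift ν
      Σ-canonicalShift Lλ N far-up far-down =
        trans (Σℤ-cong _ _ N shift-indicators) (trans (Σℤ-- _ _ N) counts)
        where
        counts : Σℤ (λ r → indicator (up? r)) N - Σℤ (λ r → indicator (down? r)) N ≡ sizeShift ν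
        counts with (ν i - s) ℤ.≤? ν p
        ... | yes le = trans (cong₂ _-_ (count-onRunnerFrom {λ′} {ν} Lλ H p (proj₁ d) (ν i - s) N (proj₂ d) far-up) no-down)
                             (ar (ν i) s (ν p) (+ proj₁ d) (proj₂ d))
          where
          d = ≤⇒offset le
          no-down : Σℤ (λ r → indicator (down? r)) N ≡ 0ℤ
          no-down = Σ-indicator-none down? N (λ r q → ℤP.<-irrefl refl
            (ℤP.<-≤-trans (bead-level (proj₁ q)) (ℤP.≤-trans (subst (ℤ._≤ ν p ℤ.+ s) (i-j+j≡i (ν i) s) (ℤP.+-monoˡ-≤ s le)) (proj₂ q))))
          ar : ∀ νi s νp d → νp ≡ νi - s ℤ.+ d → d - 0ℤ ≡ s ℤ.+ νp - νi
          ar νi s νp d refl = id νi s d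
            where
            id : ∀ νi s d → d - 0ℤ ≡ s ℤ.+ (νi - s ℤ.+ d) - νi
            id = solve-∀
        ... | no nle = trans (cong₂ _-_ no-up (count-onRunnerFrom {λ′} {ν} Lλ H i (proj₁ d) (ν p ℤ.+ s) N (proj₂ d) far-down))
                             (ar (ν i) s (ν p) (+ proj₁ d) (proj₂ d))
          where
          d = ≤⇒offset (ℤP.<⇒≤ (i<j-k⇒i+k<j (ℤP.≰⇒> nle)))
          no-up : Σℤ (λ r → indicator (up? r)) N ≡ 0ℤ
          no-up = Σ-indicator-none up? N (λ r q → ℤP.<-asym (bead-level (proj₁ q)) (ℤP.<-≤-trans (ℤP.≰⇒> nle) (proj₂ q)))
          ar : ∀ νi s νp d → νi ≡ νp ℤ.+ s ℤ.+ d → 0ℤ - d ≡ s ℤ.+ νp - νi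
          ar νi s νp d refl = id s νp d
            where
            id : ∀ s νp d → 0ℤ - d ≡ s ℤ.+ νp - (νp ℤ.+ s ℤ.+ d)
            id = solve-∀

      size-reflected : IsPartition λ′ → ∀ μ → (∀ r → beta μ r ≡ beta λ′ r ℤ.+ shiftℤ (canonicalShift i λ′ ν r)) →
                       + size μ ≡ + size λ′ ℤ.+ sizeShift ν
      size-reflected (Lλ , _) μ beta-μ = begin
        + size μ                                                         ≡⟨ cong +_ (size≡Σℕ μ N m≤N) ⟩
        + Σℕ (rowLen μ) N                                                ≡⟨ Σℕ-ℤ _ N ⟩
        Σℤ (λ r → + rowLen μ r) N                                        ≡⟨ Σℤ-cong _ _ N row ⟩
        Σℤ (λ r → + rowLen λ′ r ℤ.+ shiftℤ (canonicalShift i λ′ ν r)) N  ≡⟨ Σℤ-+ _ _ N ⟩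
        Σℤ (λ r → + rowLen λ′ r) N ℤ.+ Σℤ (λ r → shiftℤ (canonicalShift i λ′ ν r)) N
          ≡⟨ cong₂ ℤ._+_ (trans (sym (Σℕ-ℤ _ N)) (cong +_ (sym (size≡Σℕ λ′ N l≤N))))
                         (Σ-canonicalShift Lλ N (beta-far λ′ _ l≤N y₁≤N)
                                                (beta-far λ′ _ l≤N y₂≤N)) ⟩
        + size λ′ ℤ.+ sizeShift ν                                        ∎
        where
        open ≡-Reasoning
        y₁ = cell (ν i - s) p
        y₂ = cell (ν p ℤ.+ s) i
        N = length λ′ ℕ.+ length μ ℕ.+ ℤ.∣ y₁ ∣ ℕ.+ ℤ.∣ y₂ ∣
        l≤N : length λ′ ℕ.≤ N
        l≤N = ℕP.≤-trans (ℕP.m≤m+n _ _) (ℕP.≤-trans (ℕP.m≤m+n _ _) (ℕP.m≤m+n _ _))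
        m≤N : length μ ℕ.≤ N
        m≤N = ℕP.≤-trans (ℕP.m≤n+m _ (length λ′)) (ℕP.≤-trans (ℕP.m≤m+n _ _) (ℕP.m≤m+n _ _))
        y₁≤N : ℤ.∣ y₁ ∣ ℕ.≤ N
        y₁≤N = ℕP.≤-trans (ℕP.m≤n+m ℤ.∣ y₁ ∣ (length λ′ ℕ.+ length μ)) (ℕP.m≤m+n _ _)
        y₂≤N : ℤ.∣ y₂ ∣ ℕ.≤ N
        y₂≤N = ℕP.m≤n+m _ _
        row : ∀ r → + rowLen μ r ≡ + rowLen λ′ r ℤ.+ shiftℤ (canonicalShift i λ′ ν r)
        row r = ar (+ rowLen μ r) (+ rowLen λ′ r) (+ suc r) (shiftℤ (canonicalShift i λ′ ν r)) (beta-def μ r) (beta-def λ′ r) (beta-μ r)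
          where
          ar : ∀ M R r d {xm xl} → xm ≡ M - r → xl ≡ R - r → xm ≡ xl ℤ.+ d → M ≡ R ℤ.+ d
          ar M R r d refl refl h = ≡-by-difference h (id M R r d)
            where
            id : ∀ M R r d → M - (R ℤ.+ d) ≡ M - r - (R - r ℤ.+ d)
            id = solve-∀

module _ {a : ℕ} where

  negate : AffRoot a → AffRoot a
  negate (i , j , k) = (j , i , - k)

  negate-involutive : ∀ (β : AffRoot a) → negate (negate β) ≡ β
  negate-involutive (i , j , k) = cong (λ z → (i , j , z)) (ℤP.neg-involutive k)

  _≟r_ : (β γ : AffRoot a) → Dec (β ≡ γ)
  _≟r_ = ≡-dec FinP._≟_ (≡-dec FinP._≟_ ℤ._≟_)

  Proper : AffRoot a → Set
  Proper (i , j , k) = i ≢ j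

  act-· : ∀ (g u : Aff a) (β : AffRoot a) → act (g · u) β ≡ act g (act u β)
  act-· (wg ∘t γ) (w ∘t μ) (i , j , k) = cong (λ z → (wg ⟨$⟩ʳ (w ⟨$⟩ʳ i) , wg ⟨$⟩ʳ (w ⟨$⟩ʳ j) , z)) (e k (γ (w ⟨$⟩ʳ i)) (μ i) (γ (w ⟨$⟩ʳ j)) (μ j))
    where
    e : ∀ k a b c d → k - ((a ℤ.+ b) - (c ℤ.+ d)) ≡ k - (b - d) - (a - c)
    e = solve-∀

  act-identity : ∀ (β : AffRoot a) → act (identity {a}) β ≡ β
  act-identity (i , j , k) = cong (λ z → (i , j , z)) (ℤP.+-identityʳ k)

  act-inverse-act : ∀ (u : Aff a) (β : AffRoot a) → act (inverse u) (act u β) ≡ β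
  act-inverse-act (w ∘t μ) (i , j , k) rewrite Perm.inverseˡ w {i} | Perm.inverseˡ w {j} = cong (λ z → (i , j , z)) (e k (μ i) (μ j))
    where
    e : ∀ k a b → k - (a - b) - (- a - - b) ≡ k
    e = solve-∀

  act-act-inverse : ∀ (u : Aff a) (β : AffRoot a) → act u (act (inverse u) β) ≡ β
  act-act-inverse (w ∘t μ) (i , j , k) rewrite Perm.inverseʳ w {i} | Perm.inverseʳ w {j} = cong (λ z → (i , j , z)) (e k (μ (w ⟨$⟩ˡ i)) (μ (w ⟨$⟩ˡ j)))
    where
    e : ∀ k a b → k - (- a - - b) - (a - b) ≡ k
    e = solve-∀

  act-inverse-inverse : ∀ (u : Aff a) (β : AffRoot a) → act (inverse (inverse u)) β ≡ act u β
  act-inverse-inverse (w ∘t μ) (i , j , k) rewrite Perm.inverseˡ w {i} | Perm.inverseˡ w {j} | ℤP.neg-involutive (μ i) | ℤP.neg-involutive (μ j) = refl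

  act-negate : ∀ (u : Aff a) (β : AffRoot a) → act u (negate β) ≡ negate (act u β)
  act-negate (w ∘t μ) (i , j , k) = cong (λ z → (w ⟨$⟩ʳ j , w ⟨$⟩ʳ i , z)) (e k (μ i) (μ j))
    where
    e : ∀ k a b → - k - (b - a) ≡ - (k - (a - b))
    e = solve-∀

  act-proper : ∀ (u : Aff a) (β : AffRoot a) → Proper β → Proper (act u β)
  act-proper (w ∘t μ) (i , j , k) i≢j e = i≢j (trans (sym (Perm.inverseˡ w)) (trans (cong (w ⟨$⟩ˡ_) e) (Perm.inverseˡ w)))

  positive⇒proper : ∀ {β : AffRoot a} → Positive β → Proper β
  positive⇒proper {i , j , k} (inj₁ (lt , _)) e = ℕP.<-irrefl (cong toℕ e) lt
  positive⇒proper {i , j , k} (inj₂ (lt , _)) e = ℕP.<-irrefl (cong toℕ (sym e)) lt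

  positive∧negative⇒⊥ : ∀ {β : AffRoot a} → Positive β → Negative β → ⊥
  positive∧negative⇒⊥ (inj₁ (i<j , _)) (inj₁ (j<i , _)) = ℕP.<-asym i<j j<i
  positive∧negative⇒⊥ (inj₁ (_ , 0≤k)) (inj₂ (_ , k<0)) = ℤP.<-irrefl refl (ℤP.≤-<-trans 0≤k k<0)
  positive∧negative⇒⊥ (inj₂ (_ , 0<k)) (inj₁ (_ , k≤0)) = ℤP.<-irrefl refl (ℤP.<-≤-trans 0<k k≤0)
  positive∧negative⇒⊥ (inj₂ (j<i , _)) (inj₂ (i<j , _)) = ℕP.<-asym j<i i<j

  positive⊎negative : ∀ (β : AffRoot a) → Proper β → Positive β ⊎ Negative β
  positive⊎negative (i , j , k) i≢j with ℕP.<-cmp (toℕ i) (toℕ j) | ℤP.<-cmp 0ℤ k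
  ... | tri≈ _ e _ | _ = ⊥-elim (i≢j (FinP.toℕ-injective e))
  ... | tri< lt _ _ | tri< z _ _ = inj₁ (inj₁ (lt , ℤP.<⇒≤ z))
  ... | tri< lt _ _ | tri≈ _ z _ = inj₁ (inj₁ (lt , ℤP.≤-reflexive z))
  ... | tri< lt _ _ | tri> _ _ z = inj₂ (inj₂ (lt , z))
  ... | tri> _ _ gt | tri< z _ _ = inj₁ (inj₂ (gt , z))
  ... | tri> _ _ gt | tri≈ _ z _ = inj₂ (inj₁ (gt , ℤP.≤-reflexive (sym z)))
  ... | tri> _ _ gt | tri> _ _ z = inj₂ (inj₁ (gt , ℤP.<⇒≤ z))

  negative⇒positive-negate : ∀ {β : AffRoot a} → Negative β → Positive (negate β)
  negative⇒positive-negate (inj₁ (lt , le)) = inj₁ (lt , ℤP.neg-mono-≤ le)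
  negative⇒positive-negate (inj₂ (lt , l)) = inj₂ (lt , ℤP.neg-mono-< l)

  positive⇒negative-negate : ∀ {β : AffRoot a} → Positive β → Negative (negate β)
  positive⇒negative-negate (inj₁ (lt , le)) = inj₁ (lt , ℤP.neg-mono-≤ le)
  positive⇒negative-negate (inj₂ (lt , l)) = inj₂ (lt , ℤP.neg-mono-< l)

  positive-negate⇒negative : ∀ {β : AffRoot a} → Positive (negate β) → Negative β
  positive-negate⇒negative {β} h = subst Negative (negate-involutive β) (positive⇒negative-negate {negate β} h)

transpose-first : ∀ {N} (a b : Fin N) → PermC.transpose a b a ≡ b
transpose-first a b rewrite dec-true (a FinP.≟ a) refl = refl

transpose-second : ∀ {N} (a b : Fin N) → PermC.transpose a b b ≡ a
transpose-second a b with b FinP.≟ a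
... | yes e = e
... | no ne rewrite dec-true (b FinP.≟ b) refl = refl

transpose-other : ∀ {N} (a b k : Fin N) → k ≢ a → k ≢ b → PermC.transpose a b k ≡ k
transpose-other a b k na nb rewrite dec-false (k FinP.≟ a) na | dec-false (k FinP.≟ b) nb = refl

module Generators (n : ℕ) where
  open Runners n

  private
    m = suc n

  genPerm : Fin A → Fin A → Fin A
  genPerm i ρ = perm (gen m i) ⟨$⟩ʳ ρ

  genShift : Fin A → Fin A → ℤ
  genShift i ρ = translation (gen m i) ρ

  genPerm-prev : ∀ i → genPerm i (prev i) ≡ i
  genPerm-prev Fin.zero = transpose-second Fin.zero (fromℕ m)
  genPerm-prev (Fin.suc l) = transpose-first (inject₁ l) (Fin.suc l)

  genPerm-current : ∀ i → genPerm i i ≡ prev i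
  genPerm-current Fin.zero = transpose-first Fin.zero (fromℕ m)
  genPerm-current (Fin.suc l) = transpose-second (inject₁ l) (Fin.suc l)

  genPerm-other : ∀ i ρ → ρ ≢ prev i → ρ ≢ i → genPerm i ρ ≡ ρ
  genPerm-other Fin.zero ρ n₁ n₂ = transpose-other Fin.zero (fromℕ m) ρ n₂ n₁
  genPerm-other (Fin.suc l) ρ n₁ n₂ = transpose-other (inject₁ l) (Fin.suc l) ρ n₁ n₂

  genPerm⁻¹-prev : ∀ i → perm (gen m i) ⟨$⟩ˡ prev i ≡ i
  genPerm⁻¹-prev Fin.zero = transpose-first (fromℕ m) Fin.zero
  genPerm⁻¹-prev (Fin.suc l) = transpose-second (Fin.suc l) (inject₁ l)

  genPerm⁻¹-current : ∀ i → perm (gen m i) ⟨$⟩ˡ i ≡ prev i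
  genPerm⁻¹-current Fin.zero = transpose-second (fromℕ m) Fin.zero
  genPerm⁻¹-current (Fin.suc l) = transpose-first (Fin.suc l) (inject₁ l)

  genPerm⁻¹-other : ∀ i ρ → ρ ≢ prev i → ρ ≢ i → perm (gen m i) ⟨$⟩ˡ ρ ≡ ρ
  genPerm⁻¹-other Fin.zero ρ n₁ n₂ = transpose-other (fromℕ m) Fin.zero ρ n₁ n₂
  genPerm⁻¹-other (Fin.suc l) ρ n₁ n₂ = transpose-other (Fin.suc l) (inject₁ l) ρ n₂ n₁

  minusHighest-first : ∀ j → toℕ j ≡ 0 → minusHighest m j ≡ -1ℤ
  minusHighest-first j e with toℕ j ℕ.≟ 0 | toℕ j ℕ.≟ m
  ... | yes _ | yes e' = ⊥-elim (ℕP.0≢1+n (trans (sym e) e'))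
  ... | yes _ | no _ = refl
  ... | no ne | _ = ⊥-elim (ne e)

  minusHighest-last : ∀ j → toℕ j ≡ m → minusHighest m j ≡ 1ℤ
  minusHighest-last j e with toℕ j ℕ.≟ 0 | toℕ j ℕ.≟ m
  ... | yes e' | _ = ⊥-elim (ℕP.0≢1+n (trans (sym e') e))
  ... | no _ | yes _ = refl
  ... | no _ | no ne = ⊥-elim (ne e)

  minusHighest-middle : ∀ j → toℕ j ≢ 0 → toℕ j ≢ m → minusHighest m j ≡ 0ℤ
  minusHighest-middle j n₁ n₂ with toℕ j ℕ.≟ 0 | toℕ j ℕ.≟ m
  ... | yes e | _ = ⊥-elim (n₁ e)
  ... | no _ | yes e = ⊥-elim (n₂ e)
  ... | no _ | no _ = refl

  genShift-prev : ∀ i → genShift i (prev i) ≡ wrap i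
  genShift-prev Fin.zero = minusHighest-last (fromℕ m) (FinP.toℕ-fromℕ m)
  genShift-prev (Fin.suc l) = refl

  genShift-current : ∀ i → genShift i i ≡ - wrap i
  genShift-current Fin.zero = minusHighest-first Fin.zero refl
  genShift-current (Fin.suc l) = refl

  genShift-other : ∀ i ρ → ρ ≢ prev i → ρ ≢ i → genShift i ρ ≡ 0ℤ
  genShift-other Fin.zero ρ n₁ n₂ = minusHighest-middle ρ (λ e → n₂ (FinP.toℕ-injective e)) (λ e → n₁ (FinP.toℕ-injective (trans e (sym (FinP.toℕ-fromℕ m)))))
  genShift-other (Fin.suc l) ρ n₁ n₂ = refl

  simpleRoot : Fin A → AffRoot A
  simpleRoot i = (prev i , i , wrap i)

  gen-simpleRoot : ∀ i → act (gen m i) (simpleRoot i) ≡ negate (simpleRoot i)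
  gen-simpleRoot i = cong₂ _,_ (genPerm-prev i) (cong₂ _,_ (genPerm-current i) (trans (cong₂ (λ u v → wrap i - (u - v)) (genShift-prev i) (genShift-current i)) (e (wrap i))))
    where
    e : ∀ s → s - (s - - s) ≡ - s
    e = solve-∀

-- s_i permutes the positive roots other than its simple root

module Roots (n : ℕ) where
  open Runners n
  open Generators n

  private
    m = suc n

  -- α + kδ = (i , j , k) is positive iff the cell of i on level 0 lies below
  -- the cell of j on level k; this turns the action of s_i into that of σ i on ℤ.
  lowCell highCell : AffRoot A → ℤ
  lowCell (i , j , k) = cell 0ℤ i
  highCell (i , j , k) = cell k j

  positive⇒cell-< : ∀ {β} → Positive β → lowCell β ℤ.< highCell β
  positive⇒cell-< {i , j , k} (inj₁ (lt , le)) with ≤⇒<⊎≡ le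
  ... | inj₁ z = cell-< i j z
  ... | inj₂ refl = cell-<-lex⇐ lt
  positive⇒cell-< {i , j , k} (inj₂ (_ , z)) = cell-< i j z

  cell-<⇒positive : ∀ {β} → Proper β → lowCell β ℤ.< highCell β → Positive β
  cell-<⇒positive {i , j , k} i≢j lt with cell-<-lex lt
  ... | inj₂ (refl , l) = inj₁ (l , ℤP.≤-refl)
  ... | inj₁ z with ℕP.<-cmp (toℕ i) (toℕ j)
  ...   | tri< l _ _ = inj₁ (l , ℤP.<⇒≤ z)
  ...   | tri≈ _ e _ = ⊥-elim (i≢j (FinP.toℕ-injective e))
  ...   | tri> _ _ g = inj₂ (g , z)

  simpleRoot-positive : ∀ i → Positive (simpleRoot i)
  simpleRoot-positive i = cell-<⇒positive {simpleRoot i} (prev≢ i)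
    (subst (cell 0ℤ (prev i) ℤ.<_) (trans (cell-prev-+1 i 0ℤ) (cong (λ w → cell w i) (ℤP.+-identityˡ (wrap i)))) (<-offset 0 refl))

  σ′ : ∀ {P Q : Set} → Dec P → Dec Q → ℤ → ℤ
  σ′ (yes _) _ z = z ℤ.+ 1ℤ
  σ′ (no _) (yes _) z = z - 1ℤ
  σ′ (no _) (no _) z = z

  σ : Fin A → ℤ → ℤ
  σ i z = σ′ (runner z FinP.≟ prev i) (runner z FinP.≟ i) z

  σ-prev : ∀ i z → runner z ≡ prev i → σ i z ≡ z ℤ.+ 1ℤ
  σ-prev i z e with runner z FinP.≟ prev i
  ... | yes _ = refl
  ... | no ne = ⊥-elim (ne e)

  σ-current : ∀ i z → runner z ≡ i → σ i z ≡ z - 1ℤ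
  σ-current i z e with runner z FinP.≟ prev i | runner z FinP.≟ i
  ... | yes e' | _ = ⊥-elim (prev≢ i (trans (sym e') e))
  ... | no _ | yes _ = refl
  ... | no _ | no ne = ⊥-elim (ne e)

  σ-other : ∀ i z → runner z ≢ prev i → runner z ≢ i → σ i z ≡ z
  σ-other i z n₁ n₂ with runner z FinP.≟ prev i | runner z FinP.≟ i
  ... | yes e | _ = ⊥-elim (n₁ e)
  ... | no _ | yes e = ⊥-elim (n₂ e)
  ... | no _ | no _ = refl

  private
    z<z+1 : ∀ z → z ℤ.< z ℤ.+ 1ℤ
    z<z+1 z = <-offset 0 refl

    z-1<z : ∀ z → z - 1ℤ ℤ.< z
    z-1<z z = <-offset 0 (sym (i-1+1≡i z))

  σ-≤ : ∀ i z → runner z ≢ prev i → σ i z ℤ.≤ z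
  σ-≤ i z n₁ with runner z FinP.≟ prev i | runner z FinP.≟ i
  ... | yes e | _ = ⊥-elim (n₁ e)
  ... | no _ | yes _ = ℤP.<⇒≤ (z-1<z z)
  ... | no _ | no _ = ℤP.≤-refl

  σ-≥ : ∀ i z → runner z ≢ i → z ℤ.≤ σ i z
  σ-≥ i z n₂ with runner z FinP.≟ prev i | runner z FinP.≟ i
  ... | yes _ | _ = ℤP.<⇒≤ (z<z+1 z)
  ... | no _ | yes e = ⊥-elim (n₂ e)
  ... | no _ | no _ = ℤP.≤-refl

  σ-≤-+1 : ∀ i z → σ i z ℤ.≤ z ℤ.+ 1ℤ
  σ-≤-+1 i z with runner z FinP.≟ prev i | runner z FinP.≟ i
  ... | yes _ | _ = ℤP.≤-refl
  ... | no _ | yes _ = ℤP.<⇒≤ (ℤP.<-trans (z-1<z z) (z<z+1 z))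
  ... | no _ | no _ = ℤP.<⇒≤ (z<z+1 z)

  σ-≥-1 : ∀ i z → z - 1ℤ ℤ.≤ σ i z
  σ-≥-1 i z with runner z FinP.≟ prev i | runner z FinP.≟ i
  ... | yes _ | _ = ℤP.<⇒≤ (ℤP.<-trans (z-1<z z) (z<z+1 z))
  ... | no _ | yes _ = ℤP.≤-refl
  ... | no _ | no _ = ℤP.<⇒≤ (z-1<z z)

  σ-<-two-apart : ∀ i X → σ i X ℤ.< σ i (X ℤ.+ + 2)
  σ-<-two-apart i X = by-runners (runner X FinP.≟ prev i) (runner (X ℤ.+ + 2) FinP.≟ i)
    where
    e₁ : ∀ X → X ℤ.+ + 2 ≡ X ℤ.+ 1ℤ ℤ.+ 1ℤ
    e₁ = solve-∀
    e₂ : ∀ X → X ℤ.+ + 2 - 1ℤ ≡ X ℤ.+ 1ℤ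
    e₂ = solve-∀
    by-runners : Dec (runner X ≡ prev i) → Dec (runner (X ℤ.+ + 2) ≡ i) → σ i X ℤ.< σ i (X ℤ.+ + 2)
    by-runners (yes xp) (yes yi) = ⊥-elim (current-twice-absurd i (X ℤ.+ 1ℤ) (proj₁ (next-of-prev i X xp)) (subst (λ w → runner w ≡ i) (e₁ X) yi))
    by-runners (yes xp) (no ¬yi) = ℤP.<-≤-trans (subst (ℤ._< X ℤ.+ + 2) (sym (σ-prev i X xp)) (<-offset 0 (e₁ X))) (σ-≥ i _ ¬yi)
    by-runners (no ¬xp) _ = ℤP.≤-<-trans (σ-≤ i X ¬xp) (ℤP.<-≤-trans (<-offset 0 (e₂ X)) (σ-≥-1 i _))

  -- σ i moves every integer by at most one, so it can only invert an adjacent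
  -- pair z < z + 1 with z on runner prev i and z + 1 on runner i.
  σ-monotone : ∀ i X Y → X ℤ.< Y → σ i X ℤ.< σ i Y ⊎ (runner X ≡ prev i × Y ≡ X ℤ.+ 1ℤ)
  σ-monotone i X Y lt with <⇒offset lt
  ... | suc (suc d) , refl = inj₁ (ℤP.≤-<-trans (σ-≤-+1 i X) (ℤP.<-≤-trans (<-offset d (e X (+ d))) (σ-≥-1 i _)))
    where
    e : ∀ X d → X ℤ.+ (1ℤ ℤ.+ (1ℤ ℤ.+ (1ℤ ℤ.+ d))) - 1ℤ ≡ X ℤ.+ 1ℤ ℤ.+ (1ℤ ℤ.+ d)
    e = solve-∀
  ... | suc zero , refl = inj₁ (σ-<-two-apart i X)
  ... | zero , refl = by-runner (runner X FinP.≟ prev i)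
    where
    by-runner : Dec (runner X ≡ prev i) → σ i X ℤ.< σ i (X ℤ.+ 1ℤ) ⊎ (runner X ≡ prev i × X ℤ.+ 1ℤ ≡ X ℤ.+ 1ℤ)
    by-runner (yes xp) = inj₂ (xp , refl)
    by-runner (no ¬xp) = inj₁ (ℤP.≤-<-trans (σ-≤ i X ¬xp) (ℤP.<-≤-trans (z<z+1 X) (σ-≥ i _ (λ yi → ¬xp (prev-of-next i X yi)))))

  σ-cell : ∀ i t ρ → σ i (cell t ρ) ≡ cell (t ℤ.+ genShift i ρ) (genPerm i ρ)
  σ-cell i t ρ with ρ FinP.≟ prev i | ρ FinP.≟ i
  ... | yes refl | _ = trans (σ-prev i _ (runner-cell t (prev i))) (trans (cell-prev-+1 i t) (cong₂ (λ u v → cell (t ℤ.+ u) v) (sym (genShift-prev i)) (sym (genPerm-prev i))))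
  ... | no _ | yes refl = trans (σ-current i _ (runner-cell t i)) (trans (cell-current-1 i t) (cong₂ (λ u v → cell (t ℤ.+ u) v) (sym (genShift-current i)) (sym (genPerm-current i))))
  ... | no n₁ | no n₂ = begin
    σ i (cell t ρ)                                 ≡⟨ σ-other i _ (λ e → n₁ (trans (sym (runner-cell t ρ)) e)) (λ e → n₂ (trans (sym (runner-cell t ρ)) e)) ⟩
    cell t ρ                                       ≡⟨ cong (λ w → cell w ρ) (sym (ℤP.+-identityʳ t)) ⟩
    cell (t ℤ.+ 0ℤ) ρ                              ≡⟨ cong₂ (λ u v → cell (t ℤ.+ u) v) (sym (genShift-other i ρ n₁ n₂)) (sym (genPerm-other i ρ n₁ n₂)) ⟩
    cell (t ℤ.+ genShift i ρ) (genPerm i ρ)        ∎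
    where open ≡-Reasoning

  gen-preserves-positive : ∀ i γ → Positive γ → γ ≢ simpleRoot i → Positive (act (gen m i) γ)
  gen-preserves-positive i γ@(a , b , k) pγ ne with σ-monotone i (cell 0ℤ a) (cell k b) (positive⇒cell-< {γ} pγ)
  ... | inj₁ σlt = cell-<⇒positive {act (gen m i) γ} (act-proper (gen m i) γ (positive⇒proper {β = γ} pγ))
          (subst₂ ℤ._<_ low high (ℤP.+-monoˡ-< (- (aℤ ℤ.* c)) σlt))
    where
    c = genShift i a
    low : σ i (cell 0ℤ a) - aℤ ℤ.* c ≡ cell 0ℤ (genPerm i a)
    low = trans (cong (λ w → w - aℤ ℤ.* c) (σ-cell i 0ℤ a)) (trans (cell-shift-level _ c (genPerm i a)) (cong (λ w → cell w (genPerm i a)) (e c)))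
      where
      e : ∀ c → 0ℤ ℤ.+ c - c ≡ 0ℤ
      e = solve-∀
    high : σ i (cell k b) - aℤ ℤ.* c ≡ cell (k - (genShift i a - genShift i b)) (genPerm i b)
    high = trans (cong (λ w → w - aℤ ℤ.* c) (σ-cell i k b)) (trans (cell-shift-level _ c (genPerm i b)) (cong (λ w → cell w (genPerm i b)) (e k c (genShift i b))))
      where
      e : ∀ k c d → k ℤ.+ d - c ≡ k - (c - d)
      e = solve-∀
  ... | inj₂ (on-prev , adjacent) = ⊥-elim (ne (cong₂ _,_ a≡p (cong₂ _,_ (proj₂ same) (trans (proj₁ same) (ℤP.+-identityˡ (wrap i))))))
    where
    a≡p : a ≡ prev i
    a≡p = trans (sym (runner-cell 0ℤ a)) on-prev
    same = cell-injective {k} {0ℤ ℤ.+ wrap i} {b} {i} (trans adjacent (trans (cong (λ w → cell 0ℤ w ℤ.+ 1ℤ) a≡p) (cell-prev-+1 i 0ℤ)))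

  module _ (i : Fin A) where
    private
      g = gen m i
      α = simpleRoot i

    gen-negative⇒ : ∀ γ → Proper γ → Negative (act g γ) → (Negative γ × γ ≢ negate α) ⊎ γ ≡ α
    gen-negative⇒ γ i≢j ng with positive⊎negative γ i≢j
    ... | inj₂ nγ = inj₁ (nγ , λ e → positive∧negative⇒⊥ {β = α} (simpleRoot-positive i) (subst Negative gen-negate-α (subst (λ w → Negative (act g w)) e ng)))
      where
      gen-negate-α : act g (negate α) ≡ α
      gen-negate-α = trans (act-negate g α) (trans (cong negate (gen-simpleRoot i)) (negate-involutive α))
    ... | inj₁ pγ with γ ≟r α
    ...   | yes e = inj₂ e
    ...   | no ne = ⊥-elim (positive∧negative⇒⊥ {β = act g γ} (gen-preserves-positive i γ pγ ne) ng)

    gen-negative⇐ : ∀ γ → (Negative γ × γ ≢ negate α) ⊎ γ ≡ α → Negative (act g γ)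
    gen-negative⇐ γ (inj₂ refl) = subst Negative (sym (gen-simpleRoot i)) (positive⇒negative-negate {β = α} (simpleRoot-positive i))
    gen-negative⇐ γ (inj₁ (nγ , ne)) = positive-negate⇒negative {β = act g γ} (subst Positive (act-negate g γ)
      (gen-preserves-positive i (negate γ) (negative⇒positive-negate {β = γ} nγ) (λ e → ne (trans (sym (negate-involutive γ)) (cong negate e)))))

module _ {a : ℕ} where

  kOf : AffRoot a → ℤ
  kOf (_ , _ , k) = k

  enumerates-cong : ∀ {P Q : AffRoot a → Set} {L} → (∀ β → P β ⇔ Q β) → Enumerates L P → Enumerates L Q
  enumerates-cong P⇔Q (uL , mem) = uL , λ β → mk⇔ (λ h → Equivalence.to (P⇔Q β) (Equivalence.to (mem β) h))
                                                  (λ h → Equivalence.from (mem β) (Equivalence.from (P⇔Q β) h))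

  enumerates-∷ : ∀ {P Q : AffRoot a → Set} {L x} → Enumerates L P → ¬ P x → (∀ β → Q β ⇔ (P β ⊎ β ≡ x)) → Enumerates (x ∷ L) Q
  enumerates-∷ {P} {Q} {L} {x} (uL , mem) ¬Px Q⇔ = (All.tabulate (λ {β} β∈L x≡β → ¬Px (subst P (sym x≡β) (Equivalence.to (mem β) β∈L))) ∷ uL) ,
    λ β → mk⇔ (to β) (λ h → from β (Equivalence.to (Q⇔ β) h))
    where
    to : ∀ β → β ∈ (x ∷ L) → Q β
    to β (here refl) = Equivalence.from (Q⇔ β) (inj₂ refl)
    to β (there β∈L) = Equivalence.from (Q⇔ β) (inj₁ (Equivalence.to (mem β) β∈L))
    from : ∀ β → P β ⊎ β ≡ x → β ∈ (x ∷ L)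
    from β (inj₁ Pβ) = there (Equivalence.from (mem β) Pβ)
    from β (inj₂ refl) = here refl

  remove-member : ∀ {L x} → Unique L → x ∈ L →
                  Σ (List (AffRoot a)) λ L' → Unique L' × (∀ y → (y ∈ L') ⇔ (y ∈ L × y ≢ x)) × sumK L ≡ kOf x ℤ.+ sumK L'
  remove-member {y ∷ L₀} {x} (y∉ ∷ u₀) (here refl) = L₀ , u₀ , (λ z → mk⇔ (λ z∈ → there z∈ , λ z≡x → All.lookup y∉ z∈ (sym z≡x)) drop) , refl
    where
    drop : ∀ {z} → z ∈ (y ∷ L₀) × z ≢ x → z ∈ L₀
    drop (here e , ne) = ⊥-elim (ne e)
    drop (there z∈ , _) = z∈
  remove-member {y ∷ L₀} {x} (y∉ ∷ u₀) (there x∈) with remove-member u₀ x∈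
  ... | L₁ , u₁ , mem₁ , s₁ = y ∷ L₁ , (All.tabulate (λ z∈ → All.lookup y∉ (proj₁ (Equivalence.to (mem₁ _) z∈))) ∷ u₁) ,
        (λ z → mk⇔ (keep z) (restore z)) , trans (cong (λ w → kOf y ℤ.+ w) s₁) (e (kOf y) (kOf x) (sumK L₁))
    where
    e : ∀ a b c → a ℤ.+ (b ℤ.+ c) ≡ b ℤ.+ (a ℤ.+ c)
    e = solve-∀
    keep : ∀ z → z ∈ (y ∷ L₁) → z ∈ (y ∷ L₀) × z ≢ x
    keep z (here refl) = here refl , λ z≡x → All.lookup y∉ x∈ z≡x
    keep z (there z∈) = there (proj₁ (Equivalence.to (mem₁ z) z∈)) , proj₂ (Equivalence.to (mem₁ z) z∈)
    restore : ∀ z → z ∈ (y ∷ L₀) × z ≢ x → z ∈ (y ∷ L₁)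
    restore z (here e , _) = here e
    restore z (there z∈ , ne) = there (Equivalence.from (mem₁ z) (z∈ , ne))

  enumerates-remove : ∀ {P Q : AffRoot a → Set} {L x} → Enumerates L P → P x → (∀ β → Q β ⇔ (P β × β ≢ x)) →
                      Σ (List (AffRoot a)) λ L' → Enumerates L' Q × sumK L ≡ kOf x ℤ.+ sumK L'
  enumerates-remove {x = x} (uL , mem) Px Q⇔ =
    let (L' , uL' , mem' , s) = remove-member uL (Equivalence.from (mem x) Px) in
    L' , (uL' , λ β → mk⇔
      (λ β∈ → Equivalence.from (Q⇔ β) (Equivalence.to (mem β) (proj₁ (Equivalence.to (mem' β) β∈)) , proj₂ (Equivalence.to (mem' β) β∈)))
      (λ Qβ → Equivalence.from (mem' β) (Equivalence.from (mem β) (proj₁ (Equivalence.to (Q⇔ β) Qβ)) , proj₂ (Equivalence.to (Q⇔ β) Qβ)))) , s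

  ⊎≡⇒×≢ : ∀ {P Q : AffRoot a → Set} {x} → ¬ P x → (∀ β → Q β ⇔ (P β ⊎ β ≡ x)) → ∀ β → P β ⇔ (Q β × β ≢ x)
  ⊎≡⇒×≢ {P} {Q} {x} ¬Px Q⇔ β = mk⇔ (λ Pβ → Equivalence.from (Q⇔ β) (inj₁ Pβ) , λ { refl → ¬Px Pβ })
                       (λ { (Qβ , β≢x) → case (Equivalence.to (Q⇔ β) Qβ) β≢x })
    where
    case : P β ⊎ β ≡ x → β ≢ x → P β
    case (inj₁ Pβ) _ = Pβ
    case (inj₂ β≡x) β≢x = ⊥-elim (β≢x β≡x)

  ×≢⇒⊎≡ : ∀ {P Q : AffRoot a → Set} {x} → P x → (∀ β → Q β ⇔ (P β × β ≢ x)) → ∀ β → P β ⇔ (Q β ⊎ β ≡ x)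
  ×≢⇒⊎≡ {P} {Q} {x} Px Q⇔ β = mk⇔ to from
    where
    to : P β → Q β ⊎ β ≡ x
    to Pβ with β ≟r x
    ... | yes β≡x = inj₂ β≡x
    ... | no β≢x = inj₁ (Equivalence.from (Q⇔ β) (Pβ , β≢x))
    from : Q β ⊎ β ≡ x → P β
    from (inj₁ Qβ) = proj₁ (Equivalence.to (Q⇔ β) Qβ)
    from (inj₂ refl) = Px

-- Inversion sets along a word

module Inversions (n : ℕ) where
  open Runners n
  open Generators n
  open Roots n

  private
    m = suc n

  Inv : Aff A → AffRoot A → Set
  Inv u β = Positive β × Negative (act u β)

  inInv-inverse⇔ : ∀ u β → InInv (inverse u) β ⇔ Inv u β
  inInv-inverse⇔ u β = mk⇔ (λ { (pβ , nβ) → pβ , subst Negative (act-inverse-inverse u β) nβ })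
                          (λ { (pβ , nβ) → pβ , subst Negative (sym (act-inverse-inverse u β)) nβ })

  ¬inv-identity : ∀ β → ¬ Inv identity β
  ¬inv-identity β (pβ , nβ) = positive∧negative⇒⊥ {β = β} pβ (subst Negative (act-identity β) nβ)

  module _ (i : Fin A) (u : Aff A) where
    private
      g = gen m i
      α = simpleRoot i

    ζ : AffRoot A
    ζ = act (inverse u) α

    private
      act-ζ : act u ζ ≡ α
      act-ζ = act-act-inverse u α

      act-negate-ζ : act u (negate ζ) ≡ negate α
      act-negate-ζ = trans (act-negate u ζ) (cong negate act-ζ)

      act⇒≡ : ∀ {β δ} → act u β ≡ δ → β ≡ act (inverse u) δ
      act⇒≡ {β} e = trans (sym (act-inverse-act u β)) (cong (act (inverse u)) e)

      act⇒≡negate-ζ : ∀ {β} → act u β ≡ negate α → β ≡ negate ζ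
      act⇒≡negate-ζ e = trans (act⇒≡ e) (act-negate (inverse u) α)

      ζ-proper : Proper ζ
      ζ-proper = act-proper (inverse u) α (prev≢ i)

      ¬inv-ζ : ¬ Inv u ζ
      ¬inv-ζ (_ , nζ) = positive∧negative⇒⊥ {β = α} (simpleRoot-positive i) (subst Negative act-ζ nζ)

      inv-gen·⇒ : ∀ {β} → Inv (g · u) β → Positive β × ((Negative (act u β) × act u β ≢ negate α) ⊎ act u β ≡ α)
      inv-gen·⇒ {β} (pβ , ng) = pβ , gen-negative⇒ i (act u β) (act-proper u β (positive⇒proper {β = β} pβ)) (subst Negative (act-· g u β) ng)

      inv-gen·⇐ : ∀ {β} → Positive β × ((Negative (act u β) × act u β ≢ negate α) ⊎ act u β ≡ α) → Inv (g · u) β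
      inv-gen·⇐ {β} (pβ , h) = pβ , subst Negative (sym (act-· g u β)) (gen-negative⇐ i (act u β) h)

    inv-gen·-positive : Positive ζ → ∀ β → Inv (g · u) β ⇔ (Inv u β ⊎ β ≡ ζ)
    inv-gen·-positive pζ β = mk⇔ to from
      where
      to : Inv (g · u) β → Inv u β ⊎ β ≡ ζ
      to h with inv-gen·⇒ h
      ... | pβ , inj₁ (nβ , _) = inj₁ (pβ , nβ)
      ... | _ , inj₂ e = inj₂ (act⇒≡ e)
      from : Inv u β ⊎ β ≡ ζ → Inv (g · u) β
      from (inj₁ (pβ , nβ)) = inv-gen·⇐ (pβ , inj₁ (nβ , λ e → positive∧negative⇒⊥ {β = ζ} pζ
                                (positive-negate⇒negative {β = ζ} (subst Positive (act⇒≡negate-ζ e) pβ))))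
      from (inj₂ refl) = inv-gen·⇐ (pζ , inj₂ act-ζ)

    inv-gen·-negative : Negative ζ → ∀ β → Inv (g · u) β ⇔ (Inv u β × β ≢ negate ζ)
    inv-gen·-negative nζ β = mk⇔ to from
      where
      to : Inv (g · u) β → Inv u β × β ≢ negate ζ
      to h with inv-gen·⇒ h
      ... | pβ , inj₁ (nβ , ne) = (pβ , nβ) , λ e → ne (trans (cong (act u) e) act-negate-ζ)
      ... | pβ , inj₂ e = ⊥-elim (positive∧negative⇒⊥ {β = ζ} (subst Positive (act⇒≡ e) pβ) nζ)
      from : Inv u β × β ≢ negate ζ → Inv (g · u) β
      from ((pβ , nβ) , ne) = inv-gen·⇐ (pβ , inj₁ (nβ , λ e → ne (act⇒≡negate-ζ e)))

    private
      inv-negate-ζ : Negative ζ → Inv u (negate ζ)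
      inv-negate-ζ nζ = negative⇒positive-negate {β = ζ} nζ ,
                        subst Negative (sym act-negate-ζ) (positive⇒negative-negate {β = α} (simpleRoot-positive i))

    inv-step : ∀ {L} → Enumerates L (Inv u) → Σ (List (AffRoot A)) λ L' → Enumerates L' (Inv (g · u)) × sumK L' ≡ sumK L ℤ.+ kOf ζ
    inv-step {L} en with positive⊎negative ζ ζ-proper
    ... | inj₁ pζ = ζ ∷ L , enumerates-∷ en ¬inv-ζ (inv-gen·-positive pζ) , ℤP.+-comm (kOf ζ) (sumK L)
    ... | inj₂ nζ = let (L' , en' , s) = enumerates-remove en (inv-negate-ζ nζ) (inv-gen·-negative nζ) in
                    L' , en' , sym (trans (cong (ℤ._+ kOf ζ) s) (e (sumK L') (kOf ζ)))
      where
      e : ∀ s k → - k ℤ.+ s ℤ.+ k ≡ s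
      e = solve-∀

    inv-unstep : ∀ {L'} → Enumerates L' (Inv (g · u)) → Σ (List (AffRoot A)) λ L → Enumerates L (Inv u) × sumK L' ≡ sumK L ℤ.+ kOf ζ
    inv-unstep {L'} en' with positive⊎negative ζ ζ-proper
    ... | inj₁ pζ = let (L , en , s) = enumerates-remove en' (Equivalence.from (inv-gen·-positive pζ ζ) (inj₂ refl))
                                         (⊎≡⇒×≢ ¬inv-ζ (inv-gen·-positive pζ)) in
                    L , en , trans s (ℤP.+-comm (kOf ζ) (sumK L))
    ... | inj₂ nζ = negate ζ ∷ L' , enumerates-∷ en' (λ h → proj₂ (Equivalence.to (inv-gen·-negative nζ _) h) refl)
                                      (×≢⇒⊎≡ (inv-negate-ζ nζ) (inv-gen·-negative nζ)) ,
                    sym (e (sumK L') (kOf ζ))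
      where
      e : ∀ s k → - k ℤ.+ s ℤ.+ k ≡ s
      e = solve-∀

module Words (n : ℕ) where
  open Runners n
  open Action n
  open Existence n
  open Size n
  open Generators n
  open Inversions n

  private
    m = suc n

  heightsOf : Aff A → Fin A → ℤ
  heightsOf u ρ = translation u (perm u ⟨$⟩ˡ ρ)

  heightsOf-gen : ∀ i u ρ → heightsOf (gen m i · u) ρ ≡ reflectHeights i (heightsOf u) ρ
  heightsOf-gen i (w ∘t μ) ρ = trans (cong (λ v → translation (gen m i) v ℤ.+ μ (w ⟨$⟩ˡ ρ′)) (Perm.inverseʳ w)) (by-runner (ρ FinP.≟ prev i) (ρ FinP.≟ i))
    where
    ν = heightsOf (w ∘t μ)
    ρ′ = perm (gen m i) ⟨$⟩ˡ ρ
    by-runner : Dec (ρ ≡ prev i) → Dec (ρ ≡ i) → genShift i ρ′ ℤ.+ ν ρ′ ≡ reflectHeights i ν ρ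
    by-runner (yes refl) _ = trans (cong (λ v → genShift i v ℤ.+ ν v) (genPerm⁻¹-prev i))
      (trans (cong (ℤ._+ ν i) (genShift-current i)) (trans (ℤP.+-comm (- wrap i) (ν i)) (sym (reflectHeights-prev i ν))))
    by-runner (no _) (yes refl) = trans (cong (λ v → genShift i v ℤ.+ ν v) (genPerm⁻¹-current i))
      (trans (cong (ℤ._+ ν (prev i)) (genShift-prev i)) (trans (ℤP.+-comm (wrap i) (ν (prev i))) (sym (reflectHeights-current i ν))))
    by-runner (no n₁) (no n₂) = trans (cong (λ v → genShift i v ℤ.+ ν v) (genPerm⁻¹-other i ρ n₁ n₂))
      (trans (cong (ℤ._+ ν ρ) (genShift-other i ρ n₁ n₂)) (trans (ℤP.+-identityˡ (ν ρ)) (sym (reflectHeights-other i ν ρ n₁ n₂))))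

  heights-cong : ∀ {λ′ ν ν'} → Heights λ′ ν → (∀ ρ → ν ρ ≡ ν' ρ) → Heights λ′ ν'
  heights-cong H e z = (λ b → subst (level z ℤ.<_) (e (runner z)) (proj₁ (H z) b)) ,
                       (λ h → proj₂ (H z) (subst (level z ℤ.<_) (sym (e (runner z))) h))

  heights-empty : Heights [] (λ _ → 0ℤ)
  heights-empty z = to , from
    where
    to : Bead [] z → level z ℤ.< 0ℤ
    to (r , e) = neg⇒level-neg z (subst (ℤ._< 0ℤ) (trans (sym (beta-def [] r)) e) ℤ.-<+)
    negative-bead : ∀ z → z ℤ.< 0ℤ → Bead [] z
    negative-bead (+ k) (+<+ ())
    negative-bead -[1+ k ] _ = k , beta-def [] k
    from : level z ℤ.< 0ℤ → Bead [] z
    from l = negative-bead z (level-neg⇒neg z l)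

  -- The inversion gained or lost at s_i u has k = s + ν p - ν i, exactly the
  -- change of size when s_i acts on the core with heights ν.
  kOf-ζ : ∀ i u → kOf (ζ i u) ≡ sizeShift i (heightsOf u)
  kOf-ζ i (w ∘t μ) = e (wrap i) (μ (w ⟨$⟩ˡ prev i)) (μ (w ⟨$⟩ˡ i))
    where
    e : ∀ s a b → s - (- a - - b) ≡ s ℤ.+ a - b
    e = solve-∀

  sizeOfWord : List (Fin A) → ℤ
  sizeOfWord [] = 0ℤ
  sizeOfWord (i ∷ W) = sizeOfWord W ℤ.+ sizeShift i (heightsOf (eval m W))

  core-invariant : ∀ {W μ} → CoreOf A W μ → IsPartition μ × Heights μ (heightsOf (eval m W)) × (+ size μ ≡ sizeOfWord W)
  core-invariant empty = ([] , []) , heights-empty , refl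
  core-invariant {i ∷ W} {μ} (step {λ′ = λ′} c (core-μ , dif , only-if-stuck)) =
    proj₁ core-μ , heights-μ , trans (size-reflected i {λ′} {ν} H Pλ μ beta-μ) (cong (ℤ._+ sizeShift i ν) size-λ)
    where
    IH = core-invariant c
    Pλ = proj₁ IH
    H = proj₁ (proj₂ IH)
    size-λ = proj₂ (proj₂ IH)
    ν = heightsOf (eval m W)
    open Reflection i {λ′} {ν} Pλ H using (reflected; reflected-sstep; movable⇒reflected-≢)
    beta-μ = shift-canonical i {λ′} {μ} {ν} Pλ H core-μ dif
      (λ mv → only-if-stuck (reflected , proj₁ reflected-sstep , proj₁ (proj₂ reflected-sstep) , movable⇒reflected-≢ mv))
    heights-μ : Heights μ (heightsOf (eval m (i ∷ W)))
    heights-μ = heights-cong (CanonicalShift.heights i {λ′} {μ} {ν} H beta-μ) (λ ρ → sym (heightsOf-gen i (eval m W) ρ))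

  core-exists : ∀ W → Σ (List ℕ) (CoreOf A W)
  core-exists [] = [] , empty
  core-exists (i ∷ W) = Reflection.reflected i {proj₁ IH} {ν} Pλ H , step (proj₂ IH) (Reflection.reflected-sstep i {proj₁ IH} {ν} Pλ H)
    where
    IH = core-exists W
    ν = heightsOf (eval m W)
    Pλ = proj₁ (core-invariant (proj₂ IH))
    H = proj₁ (proj₂ (core-invariant (proj₂ IH)))

  inversions-exist : ∀ W → Σ (List (AffRoot A)) λ L → Enumerates L (Inv (eval m W))
  inversions-exist [] = [] , [] , λ β → mk⇔ (λ ()) (λ h → ⊥-elim (¬inv-identity β h))
  inversions-exist (i ∷ W) = let (L' , en' , _) = inv-step i (eval m W) (proj₂ (inversions-exist W)) in L' , en'

  inversions-sum : ∀ W L → Enumerates L (Inv (eval m W)) → sumK L ≡ sizeOfWord W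
  inversions-sum [] [] _ = refl
  inversions-sum [] (β ∷ L) (_ , mem) = ⊥-elim (¬inv-identity β (Equivalence.to (mem β) (here refl)))
  inversions-sum (i ∷ W) L' en' =
    let (L , en , s) = inv-unstep i (eval m W) en' in
    trans s (cong₂ ℤ._+_ (inversions-sum W L en) (kOf-ζ i (eval m W)))

-- Both sides agree for every word.
proposition6p4 : (n : ℕ) (W : List (Fin (suc (suc n)))) →
    MinCosetRep (suc n) (eval (suc n) W) →
    (Σ (List ℕ) (λ μ → CoreOf (suc (suc n)) W μ)) ×
    (Σ (List (AffRoot (suc (suc n)))) (λ L → Enumerates L (InInv (inverse (eval (suc n) W))))) ×
    ((μ : List ℕ) (L : List (AffRoot (suc (suc n)))) →
      CoreOf (suc (suc n)) W μ →
      Enumerates L (InInv (inverse (eval (suc n) W))) →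
      + size μ ≡ sumK L)
proposition6p4 n W _ =
    core-exists W
  , (proj₁ inversions , enumerates-cong (λ β → ⇔.sym (inInv-inverse⇔ u β)) (proj₂ inversions))
  , λ μ L core enum → trans (proj₂ (proj₂ (core-invariant core)))
                            (sym (inversions-sum W L (enumerates-cong (inInv-inverse⇔ u) enum)))
  where
  open Words n
  open Inversions n using (inInv-inverse⇔)
  u = eval (suc n) W
  inversions = inversions-exist W
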